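{- Let $s$ and $t$ be positive integers and let $\alpha_{s,t}\in S_{s+t+1}$ be the permutation $\alpha_{s,t} = s+1, s+2, \ldots, s+t+1, s, s-1, \ldots, 2, 1$. Then $$\sum_{n=0}^\infty |S_n(132, 213, \alpha_{s,t})| x^n = \frac{(1-x)^s + x^{t+1}\left( \sum_{i=0}^{s-1} (1-x)^i x^{s-i-1} \right)}{(1-x)^s (1 - x - \cdots - x^t)}.$$
   Context: $S_n$ is the set of permutations of $\{1,\dots,n\}$ in one-line notation. A permutation $\pi \in S_n$ contains $\sigma \in S_k$ if there are indices $i_1<\cdots<i_k$ with $\pi(i_s)<\pi(i_t)$ iff $\sigma(s)<\sigma(t)$; otherwise $\pi$ avoids $\sigma$. $S_n(R)$ is the set of $\pi \in S_n$ avoiding every element of $R$; $S_0(R)$ contains only the empty permutation. -}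

module Defs where

open import Data.Bool using (Bool; true; false; _∧_; _∨_; not; if_then_else_)
open import Data.Nat using (ℕ; zero; suc; _+_; _∸_; _<ᵇ_; _≡ᵇ_)
open import Data.List using (List; []; _∷_; map; concatMap; length; filterᵇ; upTo; reverse; _++_)
open import Data.Bool.ListAction using (all; any)
open import Data.Integer as ℤ using (ℤ; +_)

-- Permutations in one-line notation, as lists of naturals.

oneTo : ℕ → List ℕ
oneTo n = map suc (upTo n)

words : ℕ → ℕ → List (List ℕ)
words zero    n = [] ∷ []
words (suc k) n = concatMap (λ a → map (a ∷_) (words k n)) (oneTo n)

elemᵇ : ℕ → List ℕ → Bool
elemᵇ a = any (λ b → a ≡ᵇ b)

distinctᵇ : List ℕ → Bool
distinctᵇ []       = true
distinctᵇ (a ∷ as) = not (elemᵇ a as) ∧ distinctᵇ as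

isPermᵇ : ℕ → List ℕ → Bool
isPermᵇ n w = (length w ≡ᵇ n) ∧ distinctᵇ w ∧ all (λ a → elemᵇ a (oneTo n)) w

-- S_n, enumerated: permutations of {1,...,n} (each exactly once, since
-- `words n n` lists every word of length n exactly once)
perms : ℕ → List (List ℕ)
perms n = filterᵇ (isPermᵇ n) (words n n)

subseqs : ℕ → List ℕ → List (List ℕ)
subseqs zero    _        = [] ∷ []
subseqs (suc k) []       = []
subseqs (suc k) (a ∷ as) = map (a ∷_) (subseqs k as) ++ subseqs (suc k) as

_⇔ᵇ_ : Bool → Bool → Bool
true  ⇔ᵇ b = b
false ⇔ᵇ b = not b

headIso : ℕ → List ℕ → ℕ → List ℕ → Bool
headIso a (a' ∷ as) b (b' ∷ bs) =
  ((a <ᵇ a') ⇔ᵇ (b <ᵇ b')) ∧ ((a' <ᵇ a) ⇔ᵇ (b' <ᵇ b)) ∧ headIso a as b bs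
headIso a _ b _ = true

-- order isomorphism of two words of equal length:
-- u(s) < u(t) iff v(s) < v(t) for all positions s, t
orderIsoᵇ : List ℕ → List ℕ → Bool
orderIsoᵇ []       []       = true
orderIsoᵇ (a ∷ as) (b ∷ bs) = headIso a as b bs ∧ orderIsoᵇ as bs
orderIsoᵇ _        _        = false

containsᵇ : List ℕ → List ℕ → Bool
containsᵇ π σ = any (λ u → orderIsoᵇ u σ) (subseqs (length σ) π)

avoidsAllᵇ : List (List ℕ) → List ℕ → Bool
avoidsAllᵇ R π = all (λ σ → not (containsᵇ π σ)) R

countAvoiders : List (List ℕ) → ℕ → ℕ
countAvoiders R n = length (filterᵇ (avoidsAllᵇ R) (perms n))

p132 : List ℕ
p132 = 1 ∷ 3 ∷ 2 ∷ []

p213 : List ℕ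
p213 = 2 ∷ 1 ∷ 3 ∷ []

alpha : ℕ → ℕ → List ℕ
alpha s t = map (λ i → s + i) (oneTo (suc t)) ++ reverse (oneTo s)

FPS : Set
FPS = ℕ → ℤ

sumBelow : ℕ → (ℕ → ℤ) → ℤ
sumBelow zero    f = + 0
sumBelow (suc n) f = sumBelow n f ℤ.+ f n

sumFPS : ℕ → (ℕ → FPS) → FPS
sumFPS n F k = sumBelow n (λ i → F i k)

constF : ℤ → FPS
constF c zero    = c
constF c (suc _) = + 0

monoF : ℕ → FPS
monoF k n = if k ≡ᵇ n then + 1 else + 0

_⊕_ : FPS → FPS → FPS
(f ⊕ g) n = f n ℤ.+ g n

_⊖_ : FPS → FPS → FPS
(f ⊖ g) n = f n ℤ.- g n

_⊛_ : FPS → FPS → FPS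
(f ⊛ g) n = sumBelow (suc n) (λ i → f i ℤ.* g (n ∸ i))

infixl 6 _⊕_ _⊖_
infixl 7 _⊛_

_^F_ : FPS → ℕ → FPS
f ^F zero    = constF (+ 1)
f ^F (suc k) = f ⊛ (f ^F k)

oneMinusX : FPS
oneMinusX = constF (+ 1) ⊖ monoF 1

genFun : ℕ → ℕ → FPS
genFun s t n = + countAvoiders (p132 ∷ p213 ∷ alpha s t ∷ []) n

numer : ℕ → ℕ → FPS
numer s t = oneMinusX ^F s
          ⊕ monoF (suc t) ⊛ sumFPS s (λ i → (oneMinusX ^F i) ⊛ monoF (s ∸ i ∸ 1))

denom : ℕ → ℕ → FPS
denom s t = (oneMinusX ^F s) ⊛ (constF (+ 1) ⊖ sumFPS t (λ j → monoF (suc j)))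

-- A permutation avoids 132 and 213 exactly when it is layered: its first entry x is followed by
-- x+1, …, n and then, recursively, by a layered permutation of 1, …, x-1. Layered permutations of n
-- therefore correspond to compositions of n (the run lengths, top run first). As α_{s,t} is the skew
-- sum of an increasing run of length t+1 over the decreasing permutation of length s, a layered
-- permutation contains it iff some run longer than t has at least s runs below it. Read from the
-- bottom run, the admissible compositions have s unrestricted parts followed by parts at most t;
-- their generating functions satisfy V₀ = 1/(1 - x - ⋯ - xᵗ) and (1-x) Vⱼ₊₁ = 1 - x + x Vⱼ, and
-- unrolling the latter s times gives the identity in the ring of formal power series.
module Submission where

open import Defs
open import Data.Nat using (ℕ; _≤_)
open import Relation.Binary.PropositionalEquality using (_≡_)
open import Data.Nat using (suc)
open import Relation.Binary.PropositionalEquality using (refl; trans; cong)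

module PowerSeries where

  open import Data.Nat using (ℕ; zero; suc; _∸_; _<_; s≤s; _<ᵇ_)
  import Data.Nat.Properties as ℕ
  open import Data.Integer using (ℤ; +_; _+_; _*_; -_; _-_; +-*-rawRing)
  import Data.Integer.Properties as ℤ
  open import Data.Integer.Solver using (module +-*-Solver)
  open import Data.Bool using (if_then_else_)
  open import Data.Maybe using (Maybe; just; nothing)
  open import Data.Product using (_,_)
  open import Relation.Nullary using (yes; no)
  open import Relation.Binary.PropositionalEquality
  open import Algebra.Bundles using (CommutativeRing)
  open import Algebra.Structures using (IsCommutativeRing)
  import Algebra.Construct.Pointwise as Pointwise
  open import Algebra.Solver.Ring.AlmostCommutativeRing
    using (AlmostCommutativeRing; fromCommutativeRing; _-Raw-AlmostCommutative⟶_)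
  import Algebra.Solver.Ring as RingSolver
  import Relation.Binary.Reasoning.Setoid as SetoidReasoning

  infix 4 _≈_
  _≈_ : FPS → FPS → Set
  f ≈ g = ∀ n → f n ≡ g n

  sumBelow-cong : ∀ n {F G : ℕ → ℤ} → (∀ i → i < n → F i ≡ G i) → sumBelow n F ≡ sumBelow n G
  sumBelow-cong zero    F≡G = refl
  sumBelow-cong (suc n) F≡G =
    cong₂ _+_ (sumBelow-cong n (λ i i<n → F≡G i (ℕ.m<n⇒m<1+n i<n))) (F≡G n ℕ.≤-refl)

  sumBelow-+ : ∀ n (F G : ℕ → ℤ) → sumBelow n (λ i → F i + G i) ≡ sumBelow n F + sumBelow n G
  sumBelow-+ zero    F G = refl
  sumBelow-+ (suc n) F G rewrite sumBelow-+ n F G =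
    solve 4 (λ a b c d → (a :+ b) :+ (c :+ d) := (a :+ c) :+ (b :+ d)) refl
      (sumBelow n F) (sumBelow n G) (F n) (G n)
    where open +-*-Solver

  sumBelow-*ˡ : ∀ n c (F : ℕ → ℤ) → sumBelow n (λ i → c * F i) ≡ c * sumBelow n F
  sumBelow-*ˡ zero    c F = sym (ℤ.*-zeroʳ c)
  sumBelow-*ˡ (suc n) c F rewrite sumBelow-*ˡ n c F = sym (ℤ.*-distribˡ-+ c (sumBelow n F) (F n))

  sumBelow-zero : ∀ n (F : ℕ → ℤ) → (∀ i → F i ≡ + 0) → sumBelow n F ≡ + 0
  sumBelow-zero zero    F F≡0 = refl
  sumBelow-zero (suc n) F F≡0 rewrite sumBelow-zero n F F≡0 | F≡0 n = refl

  sumBelow-suc : ∀ n (F : ℕ → ℤ) → sumBelow (suc n) F ≡ F 0 + sumBelow n (λ i → F (suc i))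
  sumBelow-suc zero    F = trans (ℤ.+-identityˡ (F 0)) (sym (ℤ.+-identityʳ (F 0)))
  sumBelow-suc (suc n) F rewrite sumBelow-suc n F = ℤ.+-assoc (F 0) _ _

  shift : FPS → FPS
  shift f n = f (suc n)

  scale : ℤ → FPS → FPS
  scale c f n = c * f n

  zeroF : FPS
  zeroF _ = + 0

  negF : FPS → FPS
  negF f n = - f n

  1F : FPS
  1F = constF (+ 1)

  X : FPS
  X = monoF 1

  ⊛-coeff-zero : ∀ f g → (f ⊛ g) 0 ≡ f 0 * g 0
  ⊛-coeff-zero f g = ℤ.+-identityˡ _

  ⊛-coeff-sucˡ : ∀ f g n → (f ⊛ g) (suc n) ≡ f 0 * g (suc n) + (shift f ⊛ g) n
  ⊛-coeff-sucˡ f g n = sumBelow-suc (suc n) (λ i → f i * g (suc n ∸ i))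

  ⊛-coeff-sucʳ : ∀ f g n → (f ⊛ g) (suc n) ≡ (f ⊛ shift g) n + f (suc n) * g 0
  ⊛-coeff-sucʳ f g n = cong₂ _+_
    (sumBelow-cong (suc n) (λ i i≤n → cong (λ k → f i * g k) (ℕ.+-∸-assoc 1 (ℕ.≤-pred i≤n))))
    (cong (λ k → f (suc n) * g k) (ℕ.n∸n≡0 n))

  ⊛-comm : ∀ f g → (f ⊛ g) ≈ (g ⊛ f)
  ⊛-comm f g zero = begin
    (f ⊛ g) 0  ≡⟨ ⊛-coeff-zero f g ⟩
    f 0 * g 0  ≡⟨ ℤ.*-comm (f 0) (g 0) ⟩
    g 0 * f 0  ≡⟨ ⊛-coeff-zero g f ⟨
    (g ⊛ f) 0  ∎
    where open ≡-Reasoning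
  ⊛-comm f g (suc n) = begin
    (f ⊛ g) (suc n)                     ≡⟨ ⊛-coeff-sucˡ f g n ⟩
    f 0 * g (suc n) + (shift f ⊛ g) n   ≡⟨ cong₂ _+_ (ℤ.*-comm (f 0) (g (suc n))) (⊛-comm (shift f) g n) ⟩
    g (suc n) * f 0 + (g ⊛ shift f) n   ≡⟨ ℤ.+-comm (g (suc n) * f 0) ((g ⊛ shift f) n) ⟩
    (g ⊛ shift f) n + g (suc n) * f 0   ≡⟨ ⊛-coeff-sucʳ g f n ⟨
    (g ⊛ f) (suc n)                     ∎
    where open ≡-Reasoning

  ⊛-cong : ∀ {f f′ g g′} → f ≈ f′ → g ≈ g′ → (f ⊛ g) ≈ (f′ ⊛ g′)
  ⊛-cong f≈ g≈ n = sumBelow-cong (suc n) (λ i _ → cong₂ _*_ (f≈ i) (g≈ (n ∸ i)))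

  ⊛-distribʳ : ∀ f g h → ((f ⊕ g) ⊛ h) ≈ (f ⊛ h ⊕ g ⊛ h)
  ⊛-distribʳ f g h n =
    trans (sumBelow-cong (suc n) (λ i _ → ℤ.*-distribʳ-+ (h (n ∸ i)) (f i) (g i)))
          (sumBelow-+ (suc n) (λ i → f i * h (n ∸ i)) (λ i → g i * h (n ∸ i)))

  scale-⊛ : ∀ c f g → (scale c f ⊛ g) ≈ scale c (f ⊛ g)
  scale-⊛ c f g n =
    trans (sumBelow-cong (suc n) (λ i _ → ℤ.*-assoc c (f i) (g (n ∸ i))))
          (sumBelow-*ˡ (suc n) c (λ i → f i * g (n ∸ i)))

  ⊛-zeroˡ : ∀ f → (zeroF ⊛ f) ≈ zeroF
  ⊛-zeroˡ f n = sumBelow-zero (suc n) _ (λ i → ℤ.*-zeroˡ (f (n ∸ i)))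

  ⊛-identityˡ : ∀ f → (1F ⊛ f) ≈ f
  ⊛-identityˡ f zero    = trans (⊛-coeff-zero 1F f) (ℤ.*-identityˡ (f 0))
  ⊛-identityˡ f (suc n) = trans (⊛-coeff-sucˡ 1F f n)
    (trans (cong₂ _+_ (ℤ.*-identityˡ (f (suc n))) (⊛-zeroˡ f n)) (ℤ.+-identityʳ (f (suc n))))

  ⊛-assoc : ∀ f g h → ((f ⊛ g) ⊛ h) ≈ (f ⊛ (g ⊛ h))
  ⊛-assoc f g h zero = begin
    ((f ⊛ g) ⊛ h) 0    ≡⟨ ⊛-coeff-zero (f ⊛ g) h ⟩
    (f ⊛ g) 0 * h 0    ≡⟨ cong (_* h 0) (⊛-coeff-zero f g) ⟩
    f 0 * g 0 * h 0    ≡⟨ ℤ.*-assoc (f 0) (g 0) (h 0) ⟩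
    f 0 * (g 0 * h 0)  ≡⟨ cong (f 0 *_) (⊛-coeff-zero g h) ⟨
    f 0 * (g ⊛ h) 0    ≡⟨ ⊛-coeff-zero f (g ⊛ h) ⟨
    (f ⊛ (g ⊛ h)) 0    ∎
    where open ≡-Reasoning
  ⊛-assoc f g h (suc n) = begin
    ((f ⊛ g) ⊛ h) (suc n)
      ≡⟨ ⊛-coeff-sucˡ (f ⊛ g) h n ⟩
    (f ⊛ g) 0 * h (suc n) + (shift (f ⊛ g) ⊛ h) n
      ≡⟨ cong₂ _+_ (cong (_* h (suc n)) (⊛-coeff-zero f g)) (⊛-cong {g = h} (⊛-coeff-sucˡ f g) (λ _ → refl) n) ⟩
    f 0 * g 0 * h (suc n) + ((scale (f 0) (shift g) ⊕ shift f ⊛ g) ⊛ h) n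
      ≡⟨ cong (λ z → f 0 * g 0 * h (suc n) + z) (⊛-distribʳ (scale (f 0) (shift g)) (shift f ⊛ g) h n) ⟩
    f 0 * g 0 * h (suc n) + ((scale (f 0) (shift g) ⊛ h) n + ((shift f ⊛ g) ⊛ h) n)
      ≡⟨ cong (λ z → f 0 * g 0 * h (suc n) + z) (cong₂ _+_ (scale-⊛ (f 0) (shift g) h n) (⊛-assoc (shift f) g h n)) ⟩
    f 0 * g 0 * h (suc n) + (f 0 * (shift g ⊛ h) n + (shift f ⊛ (g ⊛ h)) n)
      ≡⟨ solve 5 (λ a b c d e → a :* b :* c :+ (a :* d :+ e) := a :* (b :* c :+ d) :+ e) refl
           (f 0) (g 0) (h (suc n)) ((shift g ⊛ h) n) ((shift f ⊛ (g ⊛ h)) n) ⟩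
    f 0 * (g 0 * h (suc n) + (shift g ⊛ h) n) + (shift f ⊛ (g ⊛ h)) n
      ≡⟨ cong (λ z → f 0 * z + (shift f ⊛ (g ⊛ h)) n) (⊛-coeff-sucˡ g h n) ⟨
    f 0 * (g ⊛ h) (suc n) + (shift f ⊛ (g ⊛ h)) n
      ≡⟨ ⊛-coeff-sucˡ f (g ⊛ h) n ⟨
    (f ⊛ (g ⊛ h)) (suc n) ∎
    where open ≡-Reasoning
          open +-*-Solver

  ⊕-⊛-isCommutativeRing : IsCommutativeRing _≈_ _⊕_ _⊛_ negF zeroF 1F
  ⊕-⊛-isCommutativeRing = record
    { isRing = record
      { +-isAbelianGroup = Pointwise.isAbelianGroup ℕ ℤ.+-0-isAbelianGroup
      ; *-cong           = ⊛-cong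
      ; *-assoc          = ⊛-assoc
      ; *-identity       = ⊛-identityˡ , λ f n → trans (⊛-comm f 1F n) (⊛-identityˡ f n)
      ; distrib          = (λ f g h n → trans (⊛-comm f (g ⊕ h) n) (trans (⊛-distribʳ g h f n)
                                          (cong₂ _+_ (⊛-comm g f n) (⊛-comm h f n))))
                         , (λ f g h → ⊛-distribʳ g h f)
      }
    ; *-comm = ⊛-comm
    }

  commutativeRing : CommutativeRing _ _
  commutativeRing = record { isCommutativeRing = ⊕-⊛-isCommutativeRing }

  constF-homomorphism : +-*-rawRing -Raw-AlmostCommutative⟶ fromCommutativeRing commutativeRing
  constF-homomorphism = record
    { ⟦_⟧    = constF
    ; +-homo = λ a b → λ { zero → refl ; (suc n) → refl }
    ; *-homo = λ a b → λ
        { zero    → sym (⊛-coeff-zero (constF a) (constF b))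
        ; (suc n) → sym (trans (⊛-coeff-sucˡ (constF a) (constF b) n)
                               (cong₂ _+_ (ℤ.*-zeroʳ a) (⊛-zeroˡ (constF b) n))) }
    ; -‿homo = λ a → λ { zero → refl ; (suc n) → refl }
    ; 0-homo = λ { zero → refl ; (suc n) → refl }
    ; 1-homo = λ n → refl
    }

  constF-≟ : ∀ a b → Maybe (constF a ≈ constF b)
  constF-≟ a b with a ℤ.≟ b
  ... | yes refl = just (λ _ → refl)
  ... | no _     = nothing

  open RingSolver +-*-rawRing (fromCommutativeRing commutativeRing) constF-homomorphism constF-≟
    using (solve; _:+_; _:-_; _:*_; _:=_; con)

  module ≈-Reasoning = SetoidReasoning (CommutativeRing.setoid commutativeRing)

  ≈-refl : ∀ {f} → f ≈ f
  ≈-refl _ = refl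

  ≈-sym : ∀ {f g} → f ≈ g → g ≈ f
  ≈-sym f≈g n = sym (f≈g n)

  ≈-trans : ∀ {f g h} → f ≈ g → g ≈ h → f ≈ h
  ≈-trans f≈g g≈h n = trans (f≈g n) (g≈h n)

  ⊕-cong : ∀ {f f′ g g′} → f ≈ f′ → g ≈ g′ → (f ⊕ g) ≈ (f′ ⊕ g′)
  ⊕-cong f≈ g≈ n = cong₂ _+_ (f≈ n) (g≈ n)

  ⊖-cong : ∀ {f f′ g g′} → f ≈ f′ → g ≈ g′ → (f ⊖ g) ≈ (f′ ⊖ g′)
  ⊖-cong f≈ g≈ n = cong₂ _-_ (f≈ n) (g≈ n)

  ⊛-zeroʳ : ∀ f → (f ⊛ zeroF) ≈ zeroF
  ⊛-zeroʳ f n = trans (⊛-comm f zeroF n) (⊛-zeroˡ f n)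

  X⊛-coeff-zero : ∀ f → (X ⊛ f) 0 ≡ + 0
  X⊛-coeff-zero f = trans (⊛-coeff-zero X f) (ℤ.*-zeroˡ (f 0))

  X⊛-coeff-suc : ∀ f n → (X ⊛ f) (suc n) ≡ f n
  X⊛-coeff-suc f n = begin
    (X ⊛ f) (suc n)                   ≡⟨ ⊛-coeff-sucˡ X f n ⟩
    + 0 * f (suc n) + (shift X ⊛ f) n ≡⟨ cong₂ _+_ (ℤ.*-zeroˡ (f (suc n))) (⊛-cong {g = f} shift-X ≈-refl n) ⟩
    + 0 + (1F ⊛ f) n                  ≡⟨ ℤ.+-identityˡ _ ⟩
    (1F ⊛ f) n                        ≡⟨ ⊛-identityˡ f n ⟩
    f n                               ∎
    where
      open ≡-Reasoning
      shift-X : shift X ≈ 1F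
      shift-X zero    = refl
      shift-X (suc n) = refl

  monoF-zero : monoF 0 ≈ 1F
  monoF-zero zero    = refl
  monoF-zero (suc n) = refl

  monoF-suc : ∀ k → monoF (suc k) ≈ (X ⊛ monoF k)
  monoF-suc k zero    = sym (X⊛-coeff-zero (monoF k))
  monoF-suc k (suc n) = sym (X⊛-coeff-suc (monoF k) n)

  sumFPS-cong : ∀ s {F G : ℕ → FPS} → (∀ i → i < s → F i ≈ G i) → sumFPS s F ≈ sumFPS s G
  sumFPS-cong s F≈G n = sumBelow-cong s (λ i i<s → F≈G i i<s n)

  ⊛-sumFPS : ∀ f s (F : ℕ → FPS) → (f ⊛ sumFPS s F) ≈ sumFPS s (λ i → f ⊛ F i)
  ⊛-sumFPS f zero    F = ⊛-zeroʳ f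
  ⊛-sumFPS f (suc s) F n =
    trans (⊛-comm f (sumFPS (suc s) F) n) (trans (⊛-distribʳ (sumFPS s F) (F s) f n)
      (cong₂ _+_ (trans (⊛-comm (sumFPS s F) f n) (⊛-sumFPS f s F n)) (⊛-comm (F s) f n)))

  powersUpTo : ℕ → FPS
  powersUpTo t = sumFPS t (λ j → monoF (suc j))

  boundedPartsDenom : ℕ → FPS
  boundedPartsDenom t = 1F ⊖ powersUpTo t

  oneMinusX⊛boundedPartsDenom : ∀ t → (oneMinusX ⊛ boundedPartsDenom t) ≈ (1F ⊖ X ⊖ X ⊕ monoF (suc t))
  oneMinusX⊛boundedPartsDenom zero = begin
    oneMinusX ⊛ (1F ⊖ zeroF)  ≈⟨ ⊛-cong {oneMinusX} ≈-refl (λ n → ℤ.+-identityʳ (1F n)) ⟩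
    oneMinusX ⊛ 1F            ≈⟨ solve 1 (λ x → (con (+ 1) :- x) :* con (+ 1) := con (+ 1) :- x :- x :+ x)
                                   (λ _ → refl) X ⟩
    1F ⊖ X ⊖ X ⊕ monoF 1      ∎
    where open ≈-Reasoning
  oneMinusX⊛boundedPartsDenom (suc t) = begin
    oneMinusX ⊛ boundedPartsDenom (suc t)
      ≈⟨ solve 3 (λ x p m → (con (+ 1) :- x) :* (con (+ 1) :- (p :+ m))
                            := (con (+ 1) :- x) :* (con (+ 1) :- p) :- (con (+ 1) :- x) :* m)
           (λ _ → refl) X (powersUpTo t) (monoF (suc t)) ⟩
    oneMinusX ⊛ boundedPartsDenom t ⊖ oneMinusX ⊛ monoF (suc t)
      ≈⟨ ⊖-cong (oneMinusX⊛boundedPartsDenom t) ≈-refl ⟩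
    (1F ⊖ X ⊖ X ⊕ monoF (suc t)) ⊖ oneMinusX ⊛ monoF (suc t)
      ≈⟨ solve 2 (λ x m → (con (+ 1) :- x :- x :+ m) :- (con (+ 1) :- x) :* m := con (+ 1) :- x :- x :+ x :* m)
           (λ _ → refl) X (monoF (suc t)) ⟩
    1F ⊖ X ⊖ X ⊕ X ⊛ monoF (suc t)
      ≈⟨ ⊕-cong {1F ⊖ X ⊖ X} ≈-refl (≈-sym (monoF-suc (suc t))) ⟩
    1F ⊖ X ⊖ X ⊕ monoF (suc (suc t)) ∎
    where open ≈-Reasoning

  numerSum : ℕ → FPS
  numerSum s = sumFPS s (λ i → (oneMinusX ^F i) ⊛ monoF (s ∸ i ∸ 1))

  numerSum-suc : ∀ s → numerSum (suc s) ≈ (X ⊛ numerSum s ⊕ oneMinusX ^F s)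
  numerSum-suc s = begin
    numerSum (suc s)
      ≈⟨ ⊕-cong (sumFPS-cong s (λ i i<s → ≈-trans (⊛-cong {oneMinusX ^F i} ≈-refl (raise i i<s))
                   (solve 3 (λ p x m → p :* (x :* m) := x :* (p :* m)) (λ _ → refl)
                      (oneMinusX ^F i) X (monoF (s ∸ i ∸ 1)))))
                (≈-trans (⊛-cong {oneMinusX ^F s} ≈-refl lastTerm) (λ n → trans (⊛-comm (oneMinusX ^F s) 1F n) (⊛-identityˡ (oneMinusX ^F s) n))) ⟩
    sumFPS s (λ i → X ⊛ ((oneMinusX ^F i) ⊛ monoF (s ∸ i ∸ 1))) ⊕ oneMinusX ^F s
      ≈⟨ ⊕-cong (≈-sym (⊛-sumFPS X s (λ i → (oneMinusX ^F i) ⊛ monoF (s ∸ i ∸ 1)))) ≈-refl ⟩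
    X ⊛ numerSum s ⊕ oneMinusX ^F s ∎
    where
      open ≈-Reasoning
      index : ∀ s i → i < s → suc s ∸ i ∸ 1 ≡ suc (s ∸ i ∸ 1)
      index (suc s) zero    _         = refl
      index (suc s) (suc i) (s≤s i<s) = index s i i<s
      raise : ∀ i → i < s → monoF (suc s ∸ i ∸ 1) ≈ (X ⊛ monoF (s ∸ i ∸ 1))
      raise i i<s n = trans (cong (λ k → monoF k n) (index s i i<s)) (monoF-suc (s ∸ i ∸ 1) n)
      lastTerm : monoF (suc s ∸ s ∸ 1) ≈ 1F
      lastTerm n = trans (cong (λ k → monoF (k ∸ 1) n) (ℕ.m+n∸n≡m 1 s)) (monoF-zero n)

  geometric : FPS
  geometric _ = + 1

  geometricBelow : ℕ → FPS
  geometricBelow t n = if n <ᵇ t then + 1 else + 0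

  geometric-unfold : geometric ≈ (1F ⊕ X ⊛ geometric)
  geometric-unfold zero    = sym (cong (λ z → + 1 + z) (X⊛-coeff-zero geometric))
  geometric-unfold (suc n) = sym (cong (λ z → + 0 + z) (X⊛-coeff-suc geometric n))

  geometric⊛oneMinusX : (geometric ⊛ oneMinusX) ≈ 1F
  geometric⊛oneMinusX = begin
    geometric ⊛ oneMinusX        ≈⟨ solve 2 (λ g x → g :* (con (+ 1) :- x) := g :- x :* g) (λ _ → refl) geometric X ⟩
    geometric ⊖ X ⊛ geometric    ≈⟨ ⊖-cong geometric-unfold ≈-refl ⟩
    (1F ⊕ X ⊛ geometric) ⊖ X ⊛ geometric
                                 ≈⟨ solve 2 (λ g x → (con (+ 1) :+ x :* g) :- x :* g := con (+ 1)) (λ _ → refl) geometric X ⟩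
    1F                           ∎
    where open ≈-Reasoning

  sumBelow-monoF : ∀ t m → sumBelow t (λ j → monoF j m) ≡ geometricBelow t m
  sumBelow-monoF zero    m       = refl
  sumBelow-monoF (suc t) zero    =
    trans (sumBelow-suc t (λ j → monoF j 0)) (cong (λ z → + 1 + z) (sumBelow-zero t _ (λ _ → refl)))
  sumBelow-monoF (suc t) (suc m) =
    trans (sumBelow-suc t (λ j → monoF j (suc m))) (trans (ℤ.+-identityˡ _) (sumBelow-monoF t m))

  X⊛geometricBelow : ∀ t → (X ⊛ geometricBelow t) ≈ powersUpTo t
  X⊛geometricBelow t zero    = trans (X⊛-coeff-zero (geometricBelow t)) (sym (sumBelow-zero t _ (λ _ → refl)))
  X⊛geometricBelow t (suc n) = trans (X⊛-coeff-suc (geometricBelow t) n) (sym (sumBelow-monoF t n))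

  -- The hypotheses are the recurrences of the generating functions Vⱼ of compositions whose parts
  -- beyond the first j are at most t: the first part is arbitrary if j > 0 and at most t if j = 0.
  module _ (t : ℕ) (V : ℕ → FPS)
           (V-coeff-zero : ∀ j → V j 0 ≡ + 1)
           (V₀-coeff-suc : ∀ n → V 0 (suc n) ≡ (geometricBelow t ⊛ V 0) n)
           (V-coeff-suc  : ∀ j n → V (suc j) (suc n) ≡ (geometric ⊛ V j) n) where

    V-unfold : ∀ j W j′ → (∀ n → V j (suc n) ≡ (W ⊛ V j′) n) → V j ≈ (1F ⊕ X ⊛ (W ⊛ V j′))
    V-unfold j W j′ V-suc zero    =
      trans (V-coeff-zero j) (sym (cong (λ z → + 1 + z) (X⊛-coeff-zero (W ⊛ V j′))))
    V-unfold j W j′ V-suc (suc n) =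
      trans (V-suc n) (sym (trans (cong (λ z → + 0 + z) (X⊛-coeff-suc (W ⊛ V j′) n)) (ℤ.+-identityˡ _)))

    V₀⊛boundedPartsDenom : (V 0 ⊛ boundedPartsDenom t) ≈ 1F
    V₀⊛boundedPartsDenom = begin
      V 0 ⊛ boundedPartsDenom t
        ≈⟨ solve 2 (λ v p → v :* (con (+ 1) :- p) := v :- p :* v) (λ _ → refl) (V 0) P ⟩
      V 0 ⊖ P ⊛ V 0
        ≈⟨ ⊖-cong (V-unfold 0 (geometricBelow t) 0 V₀-coeff-suc) ≈-refl ⟩
      (1F ⊕ X ⊛ (geometricBelow t ⊛ V 0)) ⊖ P ⊛ V 0
        ≈⟨ solve 4 (λ x w v p → (con (+ 1) :+ x :* (w :* v)) :- p :* v := con (+ 1) :+ (x :* w) :* v :- p :* v)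
             (λ _ → refl) X (geometricBelow t) (V 0) P ⟩
      1F ⊕ (X ⊛ geometricBelow t) ⊛ V 0 ⊖ P ⊛ V 0
        ≈⟨ ⊖-cong {g = P ⊛ V 0} (⊕-cong {1F} ≈-refl (⊛-cong {g = V 0} (X⊛geometricBelow t) ≈-refl)) ≈-refl ⟩
      1F ⊕ P ⊛ V 0 ⊖ P ⊛ V 0
        ≈⟨ solve 2 (λ v p → con (+ 1) :+ p :* v :- p :* v := con (+ 1)) (λ _ → refl) (V 0) P ⟩
      1F ∎
      where
        open ≈-Reasoning
        P = powersUpTo t

    V-suc⊛oneMinusX : ∀ j → (V (suc j) ⊛ oneMinusX) ≈ (oneMinusX ⊕ X ⊛ V j)
    V-suc⊛oneMinusX j = begin
      V (suc j) ⊛ oneMinusX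
        ≈⟨ ⊛-cong {g = oneMinusX} (V-unfold (suc j) geometric j (V-coeff-suc j)) ≈-refl ⟩
      (1F ⊕ X ⊛ (geometric ⊛ V j)) ⊛ oneMinusX
        ≈⟨ solve 3 (λ x g v → (con (+ 1) :+ x :* (g :* v)) :* (con (+ 1) :- x)
                              := (con (+ 1) :- x) :+ x :* v :* (g :* (con (+ 1) :- x)))
             (λ _ → refl) X geometric (V j) ⟩
      oneMinusX ⊕ X ⊛ V j ⊛ (geometric ⊛ oneMinusX)
        ≈⟨ ⊕-cong {oneMinusX} ≈-refl (⊛-cong {X ⊛ V j} ≈-refl geometric⊛oneMinusX) ⟩
      oneMinusX ⊕ X ⊛ V j ⊛ 1F
        ≈⟨ solve 2 (λ x v → (con (+ 1) :- x) :+ x :* v :* con (+ 1) := (con (+ 1) :- x) :+ x :* v)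
             (λ _ → refl) X (V j) ⟩
      oneMinusX ⊕ X ⊛ V j ∎
      where open ≈-Reasoning

    V⊛denom : ∀ s → (V s ⊛ denom s t) ≈ numer s t
    V⊛denom zero = begin
      V 0 ⊛ (1F ⊛ Q)  ≈⟨ ⊛-cong {V 0} ≈-refl (⊛-identityˡ Q) ⟩
      V 0 ⊛ Q         ≈⟨ V₀⊛boundedPartsDenom ⟩
      1F              ≈⟨ (λ n → sym (trans (cong (λ z → 1F n + z) (⊛-zeroʳ (monoF (suc t)) n)) (ℤ.+-identityʳ _))) ⟩
      numer 0 t       ∎
      where
        open ≈-Reasoning
        Q = boundedPartsDenom t
    V⊛denom (suc s) = begin
      V (suc s) ⊛ ((oneMinusX ⊛ R) ⊛ Q)
        ≈⟨ solve 4 (λ v x r q → v :* (((con (+ 1) :- x) :* r) :* q) := (v :* (con (+ 1) :- x)) :* (r :* q))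
             (λ _ → refl) (V (suc s)) X R Q ⟩
      (V (suc s) ⊛ oneMinusX) ⊛ (R ⊛ Q)
        ≈⟨ ⊛-cong {g = R ⊛ Q} (V-suc⊛oneMinusX s) ≈-refl ⟩
      (oneMinusX ⊕ X ⊛ V s) ⊛ (R ⊛ Q)
        ≈⟨ solve 4 (λ x v r q → ((con (+ 1) :- x) :+ x :* v) :* (r :* q)
                                := r :* ((con (+ 1) :- x) :* q) :+ x :* (v :* (r :* q)))
             (λ _ → refl) X (V s) R Q ⟩
      R ⊛ (oneMinusX ⊛ Q) ⊕ X ⊛ (V s ⊛ (R ⊛ Q))
        ≈⟨ ⊕-cong (⊛-cong {R} ≈-refl (oneMinusX⊛boundedPartsDenom t)) (⊛-cong {X} ≈-refl (V⊛denom s)) ⟩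
      R ⊛ (1F ⊖ X ⊖ X ⊕ M) ⊕ X ⊛ (R ⊕ M ⊛ numerSum s)
        ≈⟨ solve 4 (λ r x m b → r :* (con (+ 1) :- x :- x :+ m) :+ x :* (r :+ m :* b)
                                := (con (+ 1) :- x) :* r :+ m :* (x :* b :+ r))
             (λ _ → refl) R X M (numerSum s) ⟩
      oneMinusX ⊛ R ⊕ M ⊛ (X ⊛ numerSum s ⊕ R)
        ≈⟨ ⊕-cong {oneMinusX ⊛ R} ≈-refl (⊛-cong {M} ≈-refl (≈-sym (numerSum-suc s))) ⟩
      numer (suc s) t ∎
      where
        open ≈-Reasoning
        R = oneMinusX ^F s
        Q = boundedPartsDenom t
        M = monoF (suc t)

module Permutations where

  open import Data.Nat using (ℕ; zero; suc; pred; _+_; _∸_; _<_; _≤_; z≤n; s≤s; _<ᵇ_)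
  import Data.Nat.Properties as ℕ
  open import Data.Nat.ListAction using (sum)
  open import Data.Bool using (Bool; true; false; T; not; if_then_else_)
  open import Data.Bool.Properties using (T-∧; T-≡; T-not-≡)
  open import Data.List using (List; []; _∷_; _++_; [_]; map; length; take; drop; reverse; filterᵇ; applyUpTo; applyDownFrom)
  import Data.List.Properties as List
  open import Data.List.Membership.Propositional using (_∈_; find; lose)
  open import Data.List.Membership.Propositional.Properties
    using (∈-map⁺; ∈-map⁻; ∈-++⁺ˡ; ∈-++⁺ʳ; ∈-++⁻; ∈-∃++; ∈-filter⁺; ∈-filter⁻; ∈-concatMap⁺)
  open import Data.List.Relation.Unary.Any using (Any; here; there)
  import Data.List.Relation.Unary.Any as Any
  open import Data.List.Relation.Unary.Any.Properties using (any⁺; any⁻)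
  open import Data.List.Relation.Unary.All as All using (All; []; _∷_)
  import Data.List.Relation.Unary.All.Properties as All
  open import Data.List.Relation.Unary.AllPairs as AllPairs using (AllPairs; []; _∷_)
  open import Data.List.Relation.Unary.AllPairs.Properties using () renaming (++⁺ to AllPairs-++⁺; map⁺ to AllPairs-map⁺)
  open import Data.List.Relation.Unary.All.Properties.Core using (¬Any⇒All¬; All¬⇒¬Any)
  open import Data.List.Relation.Binary.Disjoint.Propositional using (Disjoint)
  open import Data.List.Relation.Unary.Unique.Propositional using (Unique)
  import Data.List.Relation.Unary.Unique.Propositional.Properties as Unique
  open import Data.List.Relation.Binary.Sublist.Propositional
    using (_⊆_; []; _∷_; _∷ʳ_; minimum; ⊆-refl; ⊆-trans; from∈)
  open import Data.List.Relation.Binary.Sublist.Propositional.Properties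
    using (++⁺; ++⁺ˡ; ++⁺ʳ; length-mono-≤; All-resp-⊆; take-⊆)
  open import Data.List.Relation.Binary.Permutation.Propositional using (↭-sym)
  open import Data.List.Relation.Binary.Permutation.Propositional.Properties using (↭-reverse; All-resp-↭)
  open import Data.Nat.ListAction.Properties using (sum-↭)
  open import Data.Product using (∃; _×_; _,_; proj₁; proj₂)
  open import Data.Sum using (_⊎_; inj₁; inj₂)
  open import Data.Unit using (⊤; tt)
  open import Function using (_∘_; id; Equivalence)
  open import Relation.Nullary using (¬_; yes; no; contradiction)
  open import Relation.Nullary.Decidable using (T?)
  open import Relation.Binary using (tri<; tri≈; tri>)
  open import Relation.Binary.PropositionalEquality hiding ([_])

  ++-cancel-length : ∀ {A : Set} (xs ys : List A) {zs ws} →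
    length xs ≡ length ys → xs ++ zs ≡ ys ++ ws → xs ≡ ys × zs ≡ ws
  ++-cancel-length []       []       _   eq = refl , eq
  ++-cancel-length (x ∷ xs) (y ∷ ys) len eq with refl , eq′ ← List.∷-injective eq =
    let xs≡ys , zs≡ws = ++-cancel-length xs ys (ℕ.suc-injective len) eq′ in cong (x ∷_) xs≡ys , zs≡ws

  AllPairs-resp-⊆ : ∀ {A : Set} {R : A → A → Set} {xs ys} → xs ⊆ ys → AllPairs R ys → AllPairs R xs
  AllPairs-resp-⊆ []        []          = []
  AllPairs-resp-⊆ (y ∷ʳ τ)  (_ ∷ Rys)   = AllPairs-resp-⊆ τ Rys
  AllPairs-resp-⊆ (refl ∷ τ) (Ry ∷ Rys) = All-resp-⊆ τ Ry ∷ AllPairs-resp-⊆ τ Rys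

  ⊆-++-split : ∀ {A : Set} {u : List A} xs ys → u ⊆ xs ++ ys →
    ∃ λ u₁ → ∃ λ u₂ → u ≡ u₁ ++ u₂ × u₁ ⊆ xs × u₂ ⊆ ys
  ⊆-++-split []       ys τ = [] , _ , refl , [] , τ
  ⊆-++-split (x ∷ xs) ys (.x ∷ʳ τ) =
    let u₁ , u₂ , eq , τ₁ , τ₂ = ⊆-++-split xs ys τ in u₁ , u₂ , eq , x ∷ʳ τ₁ , τ₂
  ⊆-++-split (x ∷ xs) ys (refl ∷ τ) =
    let u₁ , u₂ , eq , τ₁ , τ₂ = ⊆-++-split xs ys τ in x ∷ u₁ , u₂ , cong (x ∷_) eq , refl ∷ τ₁ , τ₂

  ++-≡-++ : ∀ {A : Set} (σ₁ σ₂ xs ys : List A) → σ₁ ++ σ₂ ≡ xs ++ ys →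
    (∃ λ r → σ₁ ≡ xs ++ r × ys ≡ r ++ σ₂) ⊎ (∃ λ r → xs ≡ σ₁ ++ r × σ₂ ≡ r ++ ys)
  ++-≡-++ []       σ₂ xs       ys eq = inj₂ (xs , refl , eq)
  ++-≡-++ (a ∷ σ₁) σ₂ []       ys eq = inj₁ (a ∷ σ₁ , refl , sym eq)
  ++-≡-++ (a ∷ σ₁) σ₂ (x ∷ xs) ys eq with refl , eq′ ← List.∷-injective eq with ++-≡-++ σ₁ σ₂ xs ys eq′
  ... | inj₁ (r , eq₁ , eq₂) = inj₁ (r , cong (a ∷_) eq₁ , eq₂)
  ... | inj₂ (r , eq₁ , eq₂) = inj₂ (r , cong (a ∷_) eq₁ , eq₂)

  ≤-+-tight : ∀ {a b p q} → a ≤ p → b ≤ q → a + b ≡ p + q → a ≡ p × b ≡ q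
  ≤-+-tight {a} {b} {p} {q} a≤p b≤q eq = a≡p , ℕ.+-cancelˡ-≡ p b q (trans (cong (_+ b) (sym a≡p)) eq)
    where
      a≡p : a ≡ p
      a≡p = ℕ.≤-antisym a≤p (ℕ.+-cancelʳ-≤ b p a (subst (p + b ≤_) (sym eq) (ℕ.+-monoʳ-≤ p b≤q)))

  drop-snoc : ∀ {A : Set} s (xs : List A) x → s ≤ length xs → drop s (xs ++ [ x ]) ≡ drop s xs ++ [ x ]
  drop-snoc zero    xs       x _        = refl
  drop-snoc (suc s) (y ∷ xs) x (s≤s s≤) = drop-snoc s xs x s≤

  drop-beyond : ∀ {A : Set} s (xs : List A) → length xs ≤ s → drop s xs ≡ []
  drop-beyond s       []       _          = List.drop-[] s
  drop-beyond (suc s) (x ∷ xs) (s≤s len≤) = drop-beyond s xs len≤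

  length-reverse-∷ʳ : ∀ {A : Set} (xs : List A) x → length (reverse xs ++ [ x ]) ≡ suc (length xs)
  length-reverse-∷ʳ xs x =
    trans (List.length-++ (reverse xs)) (trans (cong (_+ 1) (List.length-reverse xs)) (ℕ.+-comm (length xs) 1))

  T-not⁻ : ∀ b → T (not b) → ¬ T b
  T-not⁻ false _ ()

  T-not⁺ : ∀ b → ¬ T b → T (not b)
  T-not⁺ true  ¬b = ¬b tt
  T-not⁺ false _  = tt

  Unique-length-≤ : ∀ {A : Set} {xs ys : List A} → Unique xs → (∀ {x} → x ∈ xs → x ∈ ys) → length xs ≤ length ys
  Unique-length-≤ {xs = []}     _              _  = z≤n
  Unique-length-≤ {xs = x ∷ xs} (x≢xs ∷ uniq) xs⊆ with ys₁ , ys₂ , refl ← ∈-∃++ (xs⊆ (here refl)) =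
    subst (suc (length xs) ≤_) (sym (length-middle ys₁))
      (s≤s (Unique-length-≤ uniq (λ y∈ → remove ys₁ (xs⊆ (there y∈)) (All.lookup x≢xs y∈ ∘ sym))))
    where
      length-middle : ∀ ys₁ {ys₂} → length (ys₁ ++ x ∷ ys₂) ≡ suc (length (ys₁ ++ ys₂))
      length-middle []        = refl
      length-middle (_ ∷ ys₁) = cong suc (length-middle ys₁)
      remove : ∀ ys₁ {ys₂ y} → y ∈ ys₁ ++ x ∷ ys₂ → y ≢ x → y ∈ ys₁ ++ ys₂
      remove []        (here y≡x) y≢x = contradiction y≡x y≢x
      remove []        (there y∈) _   = y∈
      remove (_ ∷ ys₁) (here y≡)  _   = here y≡
      remove (_ ∷ ys₁) (there y∈) y≢x = there (remove ys₁ y∈ y≢x)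

  Unique-map⁺ : ∀ {A B : Set} {P : A → Set} {f : A → B} {xs} →
    (∀ {x y} → P x → P y → f x ≡ f y → x ≡ y) → All P xs → Unique xs → Unique (map f xs)
  Unique-map⁺ f-inj []         []            = []
  Unique-map⁺ f-inj (px ∷ pxs) (x≢xs ∷ uniq) =
    All.map⁺ (All.zipWith (λ (py , x≢y) fx≡fy → x≢y (f-inj px py fx≡fy)) (pxs , x≢xs)) ∷ Unique-map⁺ f-inj pxs uniq

  Unique-length-≡ : ∀ {A : Set} {xs ys : List A} → Unique xs → Unique ys →
    (∀ {x} → x ∈ xs → x ∈ ys) → (∀ {x} → x ∈ ys → x ∈ xs) → length xs ≡ length ys
  Unique-length-≡ uniqˣ uniqʸ xs⊆ys ys⊆xs = ℕ.≤-antisym (Unique-length-≤ uniqˣ xs⊆ys) (Unique-length-≤ uniqʸ ys⊆xs)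

  -- Order shapes and pattern containment

  comparison : ℕ → ℕ → Bool × Bool
  comparison a b = (a <ᵇ b) , (b <ᵇ a)

  -- u and v are order isomorphic iff shape u ≡ shape v
  shape : List ℕ → List (List (Bool × Bool))
  shape []       = []
  shape (a ∷ as) = map (comparison a) as ∷ shape as

  length-shape : ∀ u → length (shape u) ≡ length u
  length-shape []      = refl
  length-shape (a ∷ u) = cong suc (length-shape u)

  shape-length : ∀ {u v} → shape u ≡ shape v → length u ≡ length v
  shape-length {u} {v} eq = trans (sym (length-shape u)) (trans (cong length eq) (length-shape v))

  Contains : List ℕ → List ℕ → Set
  Contains π σ = ∃ λ u → u ⊆ π × shape u ≡ shape σ

  Contains-⊆ : ∀ {π π′ σ} → Contains π σ → π ⊆ π′ → Contains π′ σ
  Contains-⊆ (u , τ , eq) τ′ = u , ⊆-trans τ τ′ , eq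

  Contains-tail : ∀ {π b σ} → Contains π (b ∷ σ) → Contains π σ
  Contains-tail (a ∷ u , τ , eq) = u , ⊆-trans (a ∷ʳ ⊆-refl) τ , List.∷-injectiveʳ eq

  Contains-[] : ∀ π → Contains π []
  Contains-[] π = [] , minimum π , refl

  Contains-in-[] : ∀ {σ} → Contains [] σ → σ ≡ []
  Contains-in-[] {[]}    _ = refl
  Contains-in-[] {b ∷ σ} (.[] , [] , ())

  comparison-< : ∀ {a b} → a < b → comparison a b ≡ (true , false)
  comparison-< {a} {b} a<b = cong₂ _,_
    (Equivalence.to T-≡ (ℕ.<⇒<ᵇ a<b))
    (Equivalence.to T-not-≡ (T-not⁺ _ (ℕ.<-asym a<b ∘ ℕ.<ᵇ⇒< b a)))

  comparison-> : ∀ {a b} → b < a → comparison a b ≡ (false , true)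
  comparison-> {a} {b} b<a = cong₂ _,_
    (Equivalence.to T-not-≡ (T-not⁺ _ (ℕ.<-asym b<a ∘ ℕ.<ᵇ⇒< a b)))
    (Equivalence.to T-≡ (ℕ.<⇒<ᵇ b<a))

  comparison-<⁻ : ∀ a b → comparison a b ≡ (true , false) → a < b
  comparison-<⁻ a b eq = ℕ.<ᵇ⇒< a b (Equivalence.from T-≡ (cong proj₁ eq))

  comparison->⁻ : ∀ a b → comparison a b ≡ (false , true) → b < a
  comparison->⁻ a b eq = ℕ.<ᵇ⇒< b a (Equivalence.from T-≡ (cong proj₂ eq))

  comparisons-<⁻ : ∀ {a b} u v → map (comparison a) u ≡ map (comparison b) v → All (a <_) u → All (b <_) v
  comparisons-<⁻ []      []      _  _ = []
  comparisons-<⁻ (x ∷ u) (y ∷ v) eq (a<x ∷ a<u) with eq₁ , eq₂ ← List.∷-injective eq =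
    comparison-<⁻ _ _ (trans (sym eq₁) (comparison-< a<x)) ∷ comparisons-<⁻ u v eq₂ a<u

  comparisons->⁻ : ∀ {a b} u v → map (comparison a) u ≡ map (comparison b) v → All (_< a) u → All (_< b) v
  comparisons->⁻ []      []      _  _ = []
  comparisons->⁻ (x ∷ u) (y ∷ v) eq (x<a ∷ u<a) with eq₁ , eq₂ ← List.∷-injective eq =
    comparison->⁻ _ _ (trans (sym eq₁) (comparison-> x<a)) ∷ comparisons->⁻ u v eq₂ u<a

  comparisons-<⁺ : ∀ {a b} u v → length u ≡ length v → All (a <_) u → All (b <_) v →
    map (comparison a) u ≡ map (comparison b) v
  comparisons-<⁺ []      []      _   _           _           = refl
  comparisons-<⁺ (x ∷ u) (y ∷ v) len (a<x ∷ a<u) (b<y ∷ b<v) =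
    cong₂ _∷_ (trans (comparison-< a<x) (sym (comparison-< b<y)))
              (comparisons-<⁺ u v (ℕ.suc-injective len) a<u b<v)

  comparisons->⁺ : ∀ {a b} u v → length u ≡ length v → All (_< a) u → All (_< b) v →
    map (comparison a) u ≡ map (comparison b) v
  comparisons->⁺ []      []      _   _           _           = refl
  comparisons->⁺ (x ∷ u) (y ∷ v) len (x<a ∷ u<a) (y<b ∷ v<b) =
    cong₂ _∷_ (trans (comparison-> x<a) (sym (comparison-> y<b)))
              (comparisons->⁺ u v (ℕ.suc-injective len) u<a v<b)

  Increasing : List ℕ → Set
  Increasing = AllPairs _<_

  shape-Increasing : ∀ u v → shape u ≡ shape v → Increasing u → Increasing v
  shape-Increasing []      []      _  []          = []
  shape-Increasing (a ∷ u) (b ∷ v) eq (a<u ∷ inc) with eq₁ , eq₂ ← List.∷-injective eq =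
    comparisons-<⁻ u v eq₁ a<u ∷ shape-Increasing u v eq₂ inc

  Increasing-shape : ∀ u v → length u ≡ length v → Increasing u → Increasing v → shape u ≡ shape v
  Increasing-shape []      []      _   _             _             = refl
  Increasing-shape (a ∷ u) (b ∷ v) len (a<u ∷ incᵤ) (b<v ∷ incᵥ) =
    cong₂ _∷_ (comparisons-<⁺ u v (ℕ.suc-injective len) a<u b<v)
              (Increasing-shape u v (ℕ.suc-injective len) incᵤ incᵥ)

  Above : List ℕ → List ℕ → Set
  Above xs ys = All (λ x → All (_< x) ys) xs

  Above-resp-⊆ : ∀ {u₁ u₂ xs ys} → u₁ ⊆ xs → u₂ ⊆ ys → Above xs ys → Above u₁ u₂
  Above-resp-⊆ τ₁ τ₂ above = All.map (All-resp-⊆ τ₂) (All-resp-⊆ τ₁ above)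

  shape-++⁻ : ∀ u₁ u₂ v₁ v₂ → length u₁ ≡ length v₁ → shape (u₁ ++ u₂) ≡ shape (v₁ ++ v₂) →
    shape u₁ ≡ shape v₁ × shape u₂ ≡ shape v₂ × (Above u₁ u₂ → Above v₁ v₂)
  shape-++⁻ []       u₂ []       v₂ _   eq = refl , eq , λ _ → []
  shape-++⁻ (a ∷ u₁) u₂ (b ∷ v₁) v₂ len eq with eq₁ , eq₂ ← List.∷-injective eq =
    let row₁ , row₂ = ++-cancel-length (map (comparison a) u₁) (map (comparison b) v₁)
                        (trans (List.length-map _ u₁) (trans (ℕ.suc-injective len) (sym (List.length-map _ v₁))))
                        (trans (sym (List.map-++ _ u₁ u₂)) (trans eq₁ (List.map-++ _ v₁ v₂)))
        shape₁ , shape₂ , above = shape-++⁻ u₁ u₂ v₁ v₂ (ℕ.suc-injective len) eq₂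
    in cong₂ _∷_ row₁ shape₁ , shape₂ , λ { (a>u₂ ∷ u₁>u₂) → comparisons->⁻ u₂ v₂ row₂ a>u₂ ∷ above u₁>u₂ }

  shape-++⁺ : ∀ u₁ u₂ v₁ v₂ → shape u₁ ≡ shape v₁ → shape u₂ ≡ shape v₂ → Above u₁ u₂ → Above v₁ v₂ →
    shape (u₁ ++ u₂) ≡ shape (v₁ ++ v₂)
  shape-++⁺ []       u₂ []       v₂ _   eq₂ _                 _                 = eq₂
  shape-++⁺ (a ∷ u₁) u₂ (b ∷ v₁) v₂ eq₁ eq₂ (a>u₂ ∷ u₁>u₂) (b>v₂ ∷ v₁>v₂)
    with row₁ , shape₁ ← List.∷-injective eq₁ =
    cong₂ _∷_ (begin
        map (comparison a) (u₁ ++ u₂)                     ≡⟨ List.map-++ _ u₁ u₂ ⟩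
        map (comparison a) u₁ ++ map (comparison a) u₂    ≡⟨ cong₂ _++_ row₁ (comparisons->⁺ u₂ v₂ (shape-length eq₂) a>u₂ b>v₂) ⟩
        map (comparison b) v₁ ++ map (comparison b) v₂    ≡⟨ List.map-++ _ v₁ v₂ ⟨
        map (comparison b) (v₁ ++ v₂)                     ∎)
      (shape-++⁺ u₁ u₂ v₁ v₂ shape₁ eq₂ u₁>u₂ v₁>v₂)
    where open ≡-Reasoning

  Contains-skew⁻ : ∀ xs ys σ → Above xs ys → Contains (xs ++ ys) σ →
    ∃ λ σ₁ → ∃ λ σ₂ → σ ≡ σ₁ ++ σ₂ × Contains xs σ₁ × Contains ys σ₂ × Above σ₁ σ₂
  Contains-skew⁻ xs ys σ xs>ys (u , τ , eq) with ⊆-++-split xs ys τ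
  ... | u₁ , u₂ , refl , τ₁ , τ₂ =
    let k = length u₁
        k≤ : k ≤ length σ
        k≤ = subst (k ≤_) (trans (sym (List.length-++ u₁)) (shape-length eq)) (ℕ.m≤m+n k (length u₂))
        σ-split : σ ≡ take k σ ++ drop k σ
        σ-split = sym (List.take++drop≡id k σ)
        shape₁ , shape₂ , above = shape-++⁻ u₁ u₂ (take k σ) (drop k σ)
          (sym (trans (List.length-take k σ) (ℕ.m≤n⇒m⊓n≡m k≤))) (trans eq (cong shape σ-split))
    in take k σ , drop k σ , σ-split , (u₁ , τ₁ , shape₁) , (u₂ , τ₂ , shape₂) ,
       above (Above-resp-⊆ τ₁ τ₂ xs>ys)

  Contains-skew⁺ : ∀ {xs ys σ₁ σ₂} → Above xs ys → Contains xs σ₁ → Contains ys σ₂ → Above σ₁ σ₂ →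
    Contains (xs ++ ys) (σ₁ ++ σ₂)
  Contains-skew⁺ {σ₁ = σ₁} {σ₂} xs>ys (u₁ , τ₁ , eq₁) (u₂ , τ₂ , eq₂) σ₁>σ₂ =
    u₁ ++ u₂ , ++⁺ τ₁ τ₂ , shape-++⁺ u₁ u₂ σ₁ σ₂ eq₁ eq₂ (Above-resp-⊆ τ₁ τ₂ xs>ys) σ₁>σ₂

  -- Layered permutations

  block : ℕ → ℕ → List ℕ
  block a zero    = []
  block a (suc k) = suc a ∷ block (suc a) k

  decreasing : ℕ → List ℕ
  decreasing = applyDownFrom suc

  applyUpTo≡block : ∀ k a (f : ℕ → ℕ) → (∀ i → f i ≡ a + suc i) → applyUpTo f k ≡ block a k
  applyUpTo≡block zero    a f f≡ = refl
  applyUpTo≡block (suc k) a f f≡ = cong₂ _∷_ (trans (f≡ 0) (ℕ.+-comm a 1))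
    (applyUpTo≡block k (suc a) (f ∘ suc) (λ i → trans (f≡ (suc i)) (ℕ.+-suc a (suc i))))

  oneTo≡applyUpTo : ∀ k → oneTo k ≡ applyUpTo suc k
  oneTo≡applyUpTo = List.map-applyUpTo id suc

  shifted-oneTo≡block : ∀ a k → map (a +_) (oneTo k) ≡ block a k
  shifted-oneTo≡block a k = begin
    map (a +_) (oneTo k)            ≡⟨ cong (map (a +_)) (oneTo≡applyUpTo k) ⟩
    map (a +_) (applyUpTo suc k)    ≡⟨ List.map-applyUpTo suc (a +_) k ⟩
    applyUpTo (λ i → a + suc i) k   ≡⟨ applyUpTo≡block k a _ (λ _ → refl) ⟩
    block a k                       ∎
    where open ≡-Reasoning

  alpha≡ : ∀ s t → alpha s t ≡ block s (suc t) ++ decreasing s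
  alpha≡ s t = cong₂ _++_ (shifted-oneTo≡block s (suc t))
    (trans (cong reverse (oneTo≡applyUpTo s)) (List.reverse-applyUpTo suc s))

  length-block : ∀ a k → length (block a k) ≡ k
  length-block a zero    = refl
  length-block a (suc k) = cong suc (length-block (suc a) k)

  block-bounds : ∀ a k → All (λ v → a < v × v ≤ a + k) (block a k)
  block-bounds a zero    = []
  block-bounds a (suc k) =
    (ℕ.n<1+n a , subst (suc a ≤_) (sym (ℕ.+-suc a k)) (s≤s (ℕ.m≤m+n a k))) ∷
    All.map (λ { {v} (a+1<v , v≤) → ℕ.<-trans (ℕ.n<1+n a) a+1<v , subst (v ≤_) (sym (ℕ.+-suc a k)) v≤ })
            (block-bounds (suc a) k)

  block-Increasing : ∀ a k → Increasing (block a k)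
  block-Increasing a zero    = []
  block-Increasing a (suc k) = All.map proj₁ (block-bounds (suc a) k) ∷ block-Increasing (suc a) k

  ∈-block⁻ : ∀ {a k v} → v ∈ block a k → a < v × v ≤ a + k
  ∈-block⁻ {a} {k} = All.lookup (block-bounds a k)

  ∈-block⁺ : ∀ a k {v} → a < v → v ≤ a + k → v ∈ block a k
  ∈-block⁺ a zero    a<v v≤ = contradiction (ℕ.<-≤-trans a<v (subst (_ ≤_) (ℕ.+-identityʳ a) v≤)) (ℕ.<-irrefl refl)
  ∈-block⁺ a (suc k) {v} a<v v≤ with v ℕ.≟ suc a
  ... | yes refl = here refl
  ... | no  v≢   = there (∈-block⁺ (suc a) k (ℕ.≤∧≢⇒< a<v (v≢ ∘ sym)) (subst (v ≤_) (ℕ.+-suc a k) v≤))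

  decreasing-bounds : ∀ k → All (λ v → 1 ≤ v × v ≤ k) (decreasing k)
  decreasing-bounds zero    = []
  decreasing-bounds (suc k) =
    (s≤s z≤n , ℕ.≤-refl) ∷ All.map (λ (1≤v , v≤k) → 1≤v , ℕ.m≤n⇒m≤1+n v≤k) (decreasing-bounds k)

  Increasing⇒Unique : ∀ {u} → Increasing u → Unique u
  Increasing⇒Unique = AllPairs.map ℕ.<⇒≢

  Increasing-++⁻ : ∀ xs {ys} → Increasing (xs ++ ys) → All (λ x → All (x <_) ys) xs
  Increasing-++⁻ []       _           = []
  Increasing-++⁻ (x ∷ xs) (x<xs ∷ inc) = All.++⁻ʳ xs x<xs ∷ Increasing-++⁻ xs inc

  layered : List ℕ → List ℕ
  layered []      = []
  layered (m ∷ c) = block (sum c) m ++ layered c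

  length-layered : ∀ c → length (layered c) ≡ sum c
  length-layered []      = refl
  length-layered (m ∷ c) =
    trans (List.length-++ (block (sum c) m)) (cong₂ _+_ (length-block (sum c) m) (length-layered c))

  layered-bounds : ∀ c → All (λ v → 1 ≤ v × v ≤ sum c) (layered c)
  layered-bounds []      = []
  layered-bounds (m ∷ c) = All.++⁺
    (All.map (λ { {v} (lt , le) → ℕ.≤-trans (s≤s z≤n) lt , subst (v ≤_) (ℕ.+-comm (sum c) m) le }) (block-bounds (sum c) m))
    (All.map (λ (1≤v , v≤) → 1≤v , ℕ.≤-trans v≤ (ℕ.m≤n+m (sum c) m)) (layered-bounds c))

  block-above-layered : ∀ m c → Above (block (sum c) m) (layered c)
  block-above-layered m c = All.map
    (λ (lt , _) → All.map (λ (_ , le) → ℕ.≤-<-trans le lt) (layered-bounds c)) (block-bounds (sum c) m)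

  layered-Unique : ∀ c → Unique (layered c)
  layered-Unique []      = []
  layered-Unique (m ∷ c) = AllPairs-++⁺ (Increasing⇒Unique (block-Increasing (sum c) m)) (layered-Unique c)
    (All.map (λ v>c → All.map (λ w<v v≡w → ℕ.<-irrefl (sym v≡w) w<v) v>c) (block-above-layered m c))

  layered-injective : ∀ c c′ → All (1 ≤_) c → All (1 ≤_) c′ → layered c ≡ layered c′ → c ≡ c′
  layered-injective []            []             _          _            _  = refl
  layered-injective []            (zero ∷ _)     _          (() ∷ _)     _
  layered-injective (zero ∷ _)    _              (() ∷ _)   _            _
  layered-injective (suc m ∷ c)   (zero ∷ _)     _          (() ∷ _)     _
  layered-injective (suc m ∷ c)   (suc m′ ∷ c′)  (_ ∷ pos)  (_ ∷ pos′)   eq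
    with eq₁ , _ ← List.∷-injective eq =
    let sum≡ : sum c ≡ sum c′
        sum≡ = ℕ.suc-injective eq₁
        m≡ : suc m ≡ suc m′
        m≡ = ℕ.+-cancelʳ-≡ (sum c) (suc m) (suc m′)
               (trans (sym (length-layered (suc m ∷ c)))
                 (trans (cong length eq) (trans (length-layered (suc m′ ∷ c′)) (cong (suc m′ +_) (sym sum≡)))))
        _ , rest≡ = ++-cancel-length (block (sum c) (suc m)) (block (sum c′) (suc m′))
                      (trans (length-block (sum c) (suc m)) (trans m≡ (sym (length-block (sum c′) (suc m′))))) eq
    in cong₂ _∷_ m≡ (layered-injective c c′ pos pos′ rest≡)

  Contains-block⁻ : ∀ a m σ → Contains (block a m) σ → Increasing σ × length σ ≤ m
  Contains-block⁻ a m σ (u , τ , eq) =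
    shape-Increasing u σ eq (AllPairs-resp-⊆ τ (block-Increasing a m)) ,
    subst (_≤ m) (shape-length eq) (subst (length u ≤_) (length-block a m) (length-mono-≤ τ))

  Contains-block⁺ : ∀ a m σ → Increasing σ → length σ ≤ m → Contains (block a m) σ
  Contains-block⁺ a m σ inc σ≤m =
    let k = length σ
        u = take k (block a m)
        k≤ : k ≤ length (block a m)
        k≤ = subst (k ≤_) (sym (length-block a m)) σ≤m
    in u , take-⊆ k (block a m) ,
       Increasing-shape u σ (trans (List.length-take k _) (ℕ.m≤n⇒m⊓n≡m k≤))
         (AllPairs-resp-⊆ (take-⊆ k (block a m)) (block-Increasing a m)) inc

  Contains-layered-∷ : ∀ m c {σ} → Contains (layered c) σ → Contains (layered (m ∷ c)) σ
  Contains-layered-∷ m c h = Contains-⊆ h (++⁺ˡ (block (sum c) m) ⊆-refl)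

  decreasing-increasing-prefix : ∀ s σ₁ σ₂ → σ₁ ++ σ₂ ≡ decreasing s → Increasing σ₁ → ¬ σ₁ ≡ [] →
    ∃ λ k → s ≡ suc k × σ₁ ≡ [ suc k ] × σ₂ ≡ decreasing k
  decreasing-increasing-prefix s       []           σ₂ _  _ σ₁≢[] = contradiction refl σ₁≢[]
  decreasing-increasing-prefix (suc k) (x ∷ [])     σ₂ eq _ _ with refl , eq′ ← List.∷-injective eq =
    k , refl , refl , eq′
  decreasing-increasing-prefix (suc k) (x ∷ y ∷ σ₁) σ₂ eq ((x<y ∷ _) ∷ _) _ with refl , eq′ ← List.∷-injective eq =
    let y≤k = proj₂ (All.lookup (decreasing-bounds k) (subst (y ∈_) eq′ (here refl)))
    in contradiction (ℕ.<-≤-trans x<y (ℕ.m≤n⇒m≤1+n y≤k)) (ℕ.<-irrefl refl)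

  Contains-decreasing-∷⁻ : ∀ m c k → Contains (layered (m ∷ c)) (decreasing (suc k)) → Contains (layered c) (decreasing k)
  Contains-decreasing-∷⁻ m c k h with Contains-skew⁻ (block (sum c) m) (layered c) _ (block-above-layered m c) h
  ... | [] , σ₂ , refl , _ , h₂ , _ = Contains-tail h₂
  ... | x ∷ σ₁ , σ₂ , eq , h₁ , h₂ , _ =
    let inc , _ = Contains-block⁻ (sum c) m (x ∷ σ₁) h₁
        k′ , k≡ , _ , σ₂≡ = decreasing-increasing-prefix (suc k) (x ∷ σ₁) σ₂ (sym eq) inc (λ ())
    in subst (Contains (layered c)) (trans σ₂≡ (cong decreasing (sym (ℕ.suc-injective k≡)))) h₂

  Contains-decreasing-∷⁺ : ∀ m c k → 1 ≤ m → Contains (layered c) (decreasing k) →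
    Contains (layered (m ∷ c)) (decreasing (suc k))
  Contains-decreasing-∷⁺ m c k 1≤m h =
    Contains-skew⁺ (block-above-layered m c) (Contains-block⁺ (sum c) m [ suc k ] ([] ∷ []) 1≤m) h
      (All.map (λ (_ , v≤k) → s≤s v≤k) (decreasing-bounds k) ∷ [])

  Contains-decreasing⁺ : ∀ c k → All (1 ≤_) c → k ≤ length c → Contains (layered c) (decreasing k)
  Contains-decreasing⁺ c       zero    _           _       = Contains-[] (layered c)
  Contains-decreasing⁺ (m ∷ c) (suc k) (1≤m ∷ pos) (s≤s k≤) =
    Contains-decreasing-∷⁺ m c k 1≤m (Contains-decreasing⁺ c k pos k≤)

  Contains-decreasing⁻ : ∀ c k → Contains (layered c) (decreasing k) → k ≤ length c
  Contains-decreasing⁻ c       zero    _ = z≤n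
  Contains-decreasing⁻ []      (suc k) h with () ← Contains-in-[] h
  Contains-decreasing⁻ (m ∷ c) (suc k) h = s≤s (Contains-decreasing⁻ c k (Contains-decreasing-∷⁻ m c k h))

  module _ (t : ℕ) where

    α : ℕ → List ℕ
    α s = block s (suc t) ++ decreasing s

    alpha-increasing-prefix : ∀ s σ₁ σ₂ → σ₁ ++ σ₂ ≡ α s → Increasing σ₁ → Above σ₁ σ₂ → ¬ σ₁ ≡ [] →
      σ₁ ≡ block s (suc t) × σ₂ ≡ decreasing s
    alpha-increasing-prefix s σ₁ σ₂ eq inc above σ₁≢[] with ++-≡-++ σ₁ σ₂ (block s (suc t)) (decreasing s) eq
    ... | inj₁ ([] , σ₁≡ , δ≡) = trans σ₁≡ (List.++-identityʳ _) , sym δ≡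
    ... | inj₁ (y ∷ r , refl , δ≡) =
      let y≤s = proj₂ (All.lookup (decreasing-bounds s) (subst (y ∈_) (sym δ≡) (here refl)))
          s<y = All.head (All.lookup (Increasing-++⁻ (block s (suc t)) inc) (here refl))
      in contradiction (ℕ.<-≤-trans s<y (ℕ.m≤n⇒m≤1+n y≤s)) (ℕ.<-irrefl refl)
    ... | inj₂ ([] , I≡ , σ₂≡) = sym (trans I≡ (List.++-identityʳ σ₁)) , σ₂≡
    ... | inj₂ (y ∷ r , I≡ , refl) with σ₁
    ...   | []      = contradiction refl σ₁≢[]
    ...   | x ∷ σ₁′ =
      let x<y = All.head (All.head (Increasing-++⁻ (x ∷ σ₁′) (subst Increasing I≡ (block-Increasing s (suc t)))))
      in contradiction x<y (ℕ.<-asym (All.head (All.head above)))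

    Contains-alpha-∷⁻ : ∀ m c s → Contains (layered (m ∷ c)) (α s) →
      Contains (layered c) (α s) ⊎ (t < m × Contains (layered c) (decreasing s))
    Contains-alpha-∷⁻ m c s h with Contains-skew⁻ (block (sum c) m) (layered c) (α s) (block-above-layered m c) h
    ... | [] , σ₂ , refl , _ , h₂ , _ = inj₁ h₂
    ... | x ∷ σ₁ , σ₂ , eq , h₁ , h₂ , above =
      let inc , σ₁≤m = Contains-block⁻ (sum c) m (x ∷ σ₁) h₁
          σ₁≡ , σ₂≡ = alpha-increasing-prefix s (x ∷ σ₁) σ₂ (sym eq) inc above (λ ())
      in inj₂ (subst (_≤ m) (trans (cong length σ₁≡) (length-block s (suc t))) σ₁≤m ,
               subst (Contains (layered c)) σ₂≡ h₂)

    Contains-alpha-∷⁺ : ∀ m c s → t < m → Contains (layered c) (decreasing s) → Contains (layered (m ∷ c)) (α s)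
    Contains-alpha-∷⁺ m c s t<m h =
      Contains-skew⁺ (block-above-layered m c)
        (Contains-block⁺ (sum c) m (block s (suc t)) (block-Increasing s (suc t))
          (subst (_≤ m) (sym (length-block s (suc t))) t<m))
        h
        (All.map (λ (s<v , _) → All.map (λ (_ , w≤s) → ℕ.≤-<-trans w≤s s<v) (decreasing-bounds s))
                 (block-bounds s (suc t)))

    Admissible : ℕ → List ℕ → Set
    Admissible s []      = ⊤
    Admissible s (m ∷ c) = (m ≤ t ⊎ length c < s) × Admissible s c

    Admissible⇒avoids-alpha : ∀ s c → Admissible s c → ¬ Contains (layered c) (α s)
    Admissible⇒avoids-alpha s []      _ h with () ← Contains-in-[] h
    Admissible⇒avoids-alpha s (m ∷ c) (short , adm) h with Contains-alpha-∷⁻ m c s h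
    ... | inj₁ h′          = Admissible⇒avoids-alpha s c adm h′
    ... | inj₂ (t<m , hδ) with short
    ...   | inj₁ m≤t = ℕ.<⇒≱ t<m m≤t
    ...   | inj₂ c<s = ℕ.<⇒≱ c<s (Contains-decreasing⁻ c s hδ)

    avoids-alpha⇒Admissible : ∀ s c → All (1 ≤_) c → ¬ Contains (layered c) (α s) → Admissible s c
    avoids-alpha⇒Admissible s []      _           _  = tt
    avoids-alpha⇒Admissible s (m ∷ c) (1≤m ∷ pos) ¬h =
      short , avoids-alpha⇒Admissible s c pos (¬h ∘ Contains-layered-∷ m c)
      where
        short : m ≤ t ⊎ length c < s
        short with m ℕ.≤? t | length c ℕ.<? s
        ... | yes m≤t | _       = inj₁ m≤t
        ... | no  _   | yes c<s = inj₂ c<s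
        ... | no  m≰t | no  c≮s =
          contradiction (Contains-alpha-∷⁺ m c s (ℕ.≰⇒> m≰t) (Contains-decreasing⁺ c s pos (ℕ.≮⇒≥ c≮s))) ¬h

  NoIncreasingTop : List ℕ → Set
  NoIncreasingTop σ = ∀ σ₁ σ₂ → σ₁ ++ σ₂ ≡ σ → Increasing σ₁ → Above σ₁ σ₂ → σ₁ ≡ []

  layered-avoids : ∀ σ → ¬ σ ≡ [] → NoIncreasingTop σ → ∀ c → ¬ Contains (layered c) σ
  layered-avoids σ σ≢[] noTop []      h = σ≢[] (Contains-in-[] h)
  layered-avoids σ σ≢[] noTop (m ∷ c) h
    with σ₁ , σ₂ , eq , h₁ , h₂ , above ← Contains-skew⁻ (block (sum c) m) (layered c) σ (block-above-layered m c) h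
    with refl ← noTop σ₁ σ₂ (sym eq) (proj₁ (Contains-block⁻ (sum c) m σ₁ h₁)) above =
    layered-avoids σ σ≢[] noTop c (subst (Contains (layered c)) (sym eq) h₂)

  p132-NoIncreasingTop : NoIncreasingTop p132
  p132-NoIncreasingTop []                  _ _    _                          _                  = refl
  p132-NoIncreasingTop (_ ∷ [])            _ refl _                          ((s≤s () ∷ _) ∷ _)
  p132-NoIncreasingTop (_ ∷ _ ∷ [])        _ refl _                          ((s≤s () ∷ _) ∷ _)
  p132-NoIncreasingTop (_ ∷ _ ∷ _ ∷ [])    _ refl (_ ∷ (s≤s (s≤s ()) ∷ _) ∷ _) _

  p213-NoIncreasingTop : NoIncreasingTop p213
  p213-NoIncreasingTop []                  _ _    _                   _                           = refl
  p213-NoIncreasingTop (_ ∷ [])            _ refl _                   ((_ ∷ s≤s (s≤s ()) ∷ _) ∷ _)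
  p213-NoIncreasingTop (_ ∷ _ ∷ [])        _ refl ((s≤s () ∷ _) ∷ _) _
  p213-NoIncreasingTop (_ ∷ _ ∷ _ ∷ [])    _ refl ((s≤s () ∷ _) ∷ _) _

  -- Permutations avoiding 132 and 213 are layered

  shape-213 : ∀ {x d z} → d < x → x < z → shape (x ∷ d ∷ z ∷ []) ≡ shape p213
  shape-213 {x} {d} {z} d<x x<z
    rewrite comparison-> {x} {d} d<x | comparison-< {x} {z} x<z | comparison-< {d} {z} (ℕ.<-trans d<x x<z) = refl

  shape-132 : ∀ {x y z} → x < z → z < y → shape (x ∷ y ∷ z ∷ []) ≡ shape p132
  shape-132 {x} {y} {z} x<z z<y
    rewrite comparison-< {x} {y} (ℕ.<-trans x<z z<y) | comparison-< {x} {z} x<z | comparison-> {y} {z} z<y = refl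

  below-first : ∀ x D → All (λ d → ¬ x < d) (take 1 D) → All (x ≢_) D → ¬ Contains (x ∷ D) p213 → All (_< x) D
  below-first x []      _          _            _    = []
  below-first x (d ∷ D) (x≮d ∷ []) (x≢d ∷ x≢D) ¬213 = d<x ∷ All.tabulate below
    where
      d<x : d < x
      d<x = ℕ.≤∧≢⇒< (ℕ.≮⇒≥ x≮d) (x≢d ∘ sym)
      below : ∀ {z} → z ∈ D → z < x
      below {z} z∈ with ℕ.<-cmp z x
      ... | tri< z<x _ _ = z<x
      ... | tri≈ _ z≡x _ = contradiction (sym z≡x) (All.lookup x≢D z∈)
      ... | tri> _ _ x<z = contradiction (x ∷ d ∷ z ∷ [] , refl ∷ refl ∷ from∈ z∈ , shape-213 d<x x<z) ¬213

  above-first-Increasing : ∀ x π L → ¬ Contains (x ∷ π) p132 → L ⊆ π → All (x <_) L → Unique L → Increasing L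
  above-first-Increasing x π []      _    _ _           _                = []
  above-first-Increasing x π (y ∷ L) ¬132 τ (x<y ∷ x<L) (y≢L ∷ uniq) =
    All.tabulate above-y ∷ above-first-Increasing x π L ¬132 (⊆-trans (y ∷ʳ ⊆-refl) τ) x<L uniq
    where
      above-y : ∀ {z} → z ∈ L → y < z
      above-y {z} z∈ with ℕ.<-cmp y z
      ... | tri< y<z _ _ = y<z
      ... | tri≈ _ y≡z _ = contradiction y≡z (All.lookup y≢L z∈)
      ... | tri> _ _ z<y =
        contradiction (x ∷ y ∷ z ∷ [] , refl ∷ ⊆-trans (refl ∷ from∈ z∈) τ , shape-132 (All.lookup x<L z∈) z<y) ¬132

  Increasing-length-≤ : ∀ L b c → Increasing L → All (λ v → b < v × v ≤ c) L → length L ≤ c ∸ b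
  Increasing-length-≤ []      b c _             _                  = z≤n
  Increasing-length-≤ (h ∷ L) b c (h<L ∷ inc) ((b<h , h≤c) ∷ bounds) =
    ℕ.≤-trans (s≤s (Increasing-length-≤ L h c inc (All.zipWith (λ (h<v , _ , v≤c) → h<v , v≤c) (h<L , bounds))))
              (ℕ.∸-monoʳ-< b<h h≤c)

  Increasing-interval : ∀ k a U → Increasing U → All (λ v → a < v × v ≤ a + k) U → length U ≡ k → U ≡ block a k
  Increasing-interval zero    a []      _           _                  _   = refl
  Increasing-interval (suc k) a (h ∷ U) (h<U ∷ inc) ((a<h , h≤) ∷ bounds) len =
    cong₂ _∷_ h≡ (Increasing-interval k (suc a) U inc
      (All.zipWith (λ { {v} (h<v , _ , v≤) → subst (_< v) h≡ h<v , subst (v ≤_) (ℕ.+-suc a k) v≤ }) (h<U , bounds))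
      (ℕ.suc-injective len))
    where
      k≤ : k ≤ (a + suc k) ∸ h
      k≤ = subst (_≤ (a + suc k) ∸ h) (ℕ.suc-injective len)
             (Increasing-length-≤ U h (a + suc k) inc (All.zipWith (λ (h<v , _ , v≤) → h<v , v≤) (h<U , bounds)))
      h+k≤ : h + k ≤ suc a + k
      h+k≤ = subst₂ _≤_ refl (ℕ.+-suc a k) (subst (h + k ≤_) (ℕ.m+[n∸m]≡n h≤) (ℕ.+-monoʳ-≤ h k≤))
      h≡ : h ≡ suc a
      h≡ = ℕ.≤-antisym (ℕ.+-cancelʳ-≤ k h (suc a) h+k≤) a<h

  IsPermutation : ℕ → List ℕ → Set
  IsPermutation n w = length w ≡ n × Unique w × All (λ a → 1 ≤ a × a ≤ n) w

  splitAbove : ∀ x π → ∃ λ U → ∃ λ D → π ≡ U ++ D × All (x <_) U × All (λ d → ¬ x < d) (take 1 D)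
  splitAbove x []      = [] , [] , refl , [] , []
  splitAbove x (y ∷ π) with x ℕ.<? y
  ... | no  x≮y = [] , y ∷ π , refl , [] , x≮y ∷ []
  ... | yes x<y with U , D , refl , x<U , x≮D ← splitAbove x π = y ∷ U , D , refl , x<y ∷ x<U , x≮D

  first-block : ∀ n x π → IsPermutation (suc n) (suc x ∷ π) →
    ¬ Contains (suc x ∷ π) p132 → ¬ Contains (suc x ∷ π) p213 →
    ∃ λ D → π ≡ block (suc x) (n ∸ x) ++ D × IsPermutation x D
  first-block n x π (len , x≢π ∷ uniq , (_ , s≤s x≤n) ∷ bounds) ¬132 ¬213
    with U , D , refl , x<U , x≮D ← splitAbove (suc x) π =
    D , cong (_++ D) U≡ , |D|≡ , uniqD , boundsD
    where
      D<x : All (_< suc x) D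
      D<x = below-first (suc x) D x≮D (All.++⁻ʳ U x≢π) (λ h → ¬213 (Contains-⊆ {σ = p213} h (refl ∷ ++⁺ˡ U ⊆-refl)))
      uniqU : Unique U
      uniqU = AllPairs-resp-⊆ (++⁺ʳ D ⊆-refl) uniq
      uniqD : Unique D
      uniqD = AllPairs-resp-⊆ (++⁺ˡ U ⊆-refl) uniq
      boundsU : All (λ v → suc x < v × v ≤ suc n) U
      boundsU = All.zipWith (λ (x<v , _ , v≤) → x<v , v≤) (x<U , All.++⁻ˡ U bounds)
      boundsD : All (λ v → 1 ≤ v × v ≤ x) D
      boundsD = All.zipWith (λ (v<x , 1≤v , _) → 1≤v , ℕ.≤-pred v<x) (D<x , All.++⁻ʳ U bounds)
      incU : Increasing U
      incU = above-first-Increasing (suc x) (U ++ D) U ¬132 (++⁺ʳ D ⊆-refl) x<U uniqU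
      |U|≤ : length U ≤ n ∸ x
      |U|≤ = Increasing-length-≤ U (suc x) (suc n) incU boundsU
      |D|≤ : length D ≤ x
      |D|≤ = subst (length D ≤_) (length-block 0 x)
               (Unique-length-≤ uniqD (λ v∈ → let 1≤v , v≤x = All.lookup boundsD v∈ in ∈-block⁺ 0 x 1≤v v≤x))
      total : length U + length D ≡ (n ∸ x) + x
      total = trans (sym (List.length-++ U)) (trans (ℕ.suc-injective len) (sym (ℕ.m∸n+n≡m x≤n)))
      |U|≡ : length U ≡ n ∸ x
      |U|≡ = proj₁ (≤-+-tight |U|≤ |D|≤ total)
      |D|≡ : length D ≡ x
      |D|≡ = proj₂ (≤-+-tight |U|≤ |D|≤ total)
      U≡ : U ≡ block (suc x) (n ∸ x)
      U≡ = Increasing-interval (n ∸ x) (suc x) U incU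
             (All.map (λ { {v} (x<v , v≤) → x<v , subst (v ≤_) (sym (ℕ.m+[n∸m]≡n (s≤s x≤n))) v≤ }) boundsU) |U|≡

  avoider-layered : ∀ n π → IsPermutation n π → ¬ Contains π p132 → ¬ Contains π p213 →
    ∃ λ c → All (1 ≤_) c × sum c ≡ n × π ≡ layered c
  avoider-layered n π = go n n π ℕ.≤-refl
    where
      go : ∀ fuel n π → n ≤ fuel → IsPermutation n π → ¬ Contains π p132 → ¬ Contains π p213 →
        ∃ λ c → All (1 ≤_) c × sum c ≡ n × π ≡ layered c
      go _          zero    []            _         _                                _    _    = [] , [] , refl , refl
      go (suc fuel) (suc n) (suc x ∷ π)   (s≤s n≤f) perm@(_ , _ , (_ , s≤s x≤n) ∷ _) ¬132 ¬213
        with D , refl , permD ← first-block n x π perm ¬132 ¬213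
        with c , pos , refl , refl ← go fuel x D (ℕ.≤-trans x≤n n≤f) permD
               (λ h → ¬132 (Contains-⊆ {σ = p132} h (suc x ∷ʳ ++⁺ˡ _ ⊆-refl)))
               (λ h → ¬213 (Contains-⊆ {σ = p213} h (suc x ∷ʳ ++⁺ˡ _ ⊆-refl))) =
        suc (n ∸ sum c) ∷ c , s≤s z≤n ∷ pos , cong suc (ℕ.m∸n+n≡m x≤n) , refl

  -- Compositions

  IsComposition : ℕ → List ℕ → Set
  IsComposition n c = All (1 ≤_) c × sum c ≡ n

  module _ (t : ℕ) where

    partAllowed : ℕ → ℕ → Bool
    partAllowed zero    m = m <ᵇ suc t
    partAllowed (suc j) m = true

    partAllowed⁺ : ∀ j m rc → All (_≤ t) (drop j (m ∷ rc)) → T (partAllowed j m) × All (_≤ t) (drop (pred j) rc)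
    partAllowed⁺ zero    m rc (m≤t ∷ rc≤t) = ℕ.<⇒<ᵇ (s≤s m≤t) , rc≤t
    partAllowed⁺ (suc j) m rc rc≤t         = tt , rc≤t

    partAllowed⁻ : ∀ j m rc → T (partAllowed j m) → All (_≤ t) (drop (pred j) rc) → All (_≤ t) (drop j (m ∷ rc))
    partAllowed⁻ zero    m rc ok rc≤t = ℕ.≤-pred (ℕ.<ᵇ⇒< m (suc t) ok) ∷ rc≤t
    partAllowed⁻ (suc j) m rc _  rc≤t = rc≤t

    -- compositions f j n: the compositions of n whose parts after the first j are at most t, provided
    -- the fuel f is at least n; withFirstPart f j n k: those of n+1 with first part at most k.
    mutual
      compositions : ℕ → ℕ → ℕ → List (List ℕ)
      compositions f       j zero    = [] ∷ []
      compositions zero    j (suc n) = []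
      compositions (suc f) j (suc n) = withFirstPart f j n (suc n)

      withFirstPart : ℕ → ℕ → ℕ → ℕ → List (List ℕ)
      withFirstPart f j n zero    = []
      withFirstPart f j n (suc k) = withFirstPart f j n k ++ firstPartExactly f j n k

      firstPartExactly : ℕ → ℕ → ℕ → ℕ → List (List ℕ)
      firstPartExactly f j n k =
        if partAllowed j (suc k) then map (suc k ∷_) (compositions f (pred j) (n ∸ k)) else []

    mutual
      compositions-fuel : ∀ f f′ j n → n ≤ f → n ≤ f′ → compositions f j n ≡ compositions f′ j n
      compositions-fuel f       f′       j zero    _       _        = refl
      compositions-fuel (suc f) (suc f′) j (suc n) (s≤s n≤) (s≤s n≤′) = withFirstPart-fuel f f′ j n n≤ n≤′ (suc n)

      withFirstPart-fuel : ∀ f f′ j n → n ≤ f → n ≤ f′ → ∀ k → withFirstPart f j n k ≡ withFirstPart f′ j n k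
      withFirstPart-fuel f f′ j n n≤ n≤′ zero    = refl
      withFirstPart-fuel f f′ j n n≤ n≤′ (suc k) = cong₂ _++_ (withFirstPart-fuel f f′ j n n≤ n≤′ k)
        (cong (λ cs → if partAllowed j (suc k) then map (suc k ∷_) cs else [])
              (compositions-fuel f f′ (pred j) (n ∸ k) (ℕ.≤-trans (ℕ.m∸n≤m n k) n≤) (ℕ.≤-trans (ℕ.m∸n≤m n k) n≤′)))

    ∈-firstPartExactly⁻ : ∀ f j n k {rc} → rc ∈ firstPartExactly f j n k →
      ∃ λ rest → rc ≡ suc k ∷ rest × T (partAllowed j (suc k)) × rest ∈ compositions f (pred j) (n ∸ k)
    ∈-firstPartExactly⁻ f j n k rc∈ with partAllowed j (suc k)
    ... | true with rest , rest∈ , refl ← ∈-map⁻ (suc k ∷_) rc∈ = rest , refl , tt , rest∈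

    ∈-withFirstPart⁻ : ∀ f j n k {rc} → rc ∈ withFirstPart f j n k →
      ∃ λ m → ∃ λ rest → rc ≡ suc m ∷ rest × m < k × T (partAllowed j (suc m)) × rest ∈ compositions f (pred j) (n ∸ m)
    ∈-withFirstPart⁻ f j n (suc k) rc∈ with ∈-++⁻ (withFirstPart f j n k) rc∈
    ... | inj₁ rc∈ˡ = let m , rest , eq , m<k , ok , rest∈ = ∈-withFirstPart⁻ f j n k rc∈ˡ
                      in m , rest , eq , ℕ.m<n⇒m<1+n m<k , ok , rest∈
    ... | inj₂ rc∈ʳ = let rest , eq , ok , rest∈ = ∈-firstPartExactly⁻ f j n k rc∈ʳ
                      in k , rest , eq , ℕ.n<1+n k , ok , rest∈

    ∈-withFirstPart⁺ : ∀ f j n k m rest → m < k → T (partAllowed j (suc m)) →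
      rest ∈ compositions f (pred j) (n ∸ m) → (suc m ∷ rest) ∈ withFirstPart f j n k
    ∈-withFirstPart⁺ f j n (suc k) m rest m<1+k ok rest∈ with m ℕ.≟ k
    ... | no  m≢k  = ∈-++⁺ˡ (∈-withFirstPart⁺ f j n k m rest (ℕ.≤∧≢⇒< (ℕ.≤-pred m<1+k) m≢k) ok rest∈)
    ... | yes refl with partAllowed j (suc m) | ok
    ...   | true | _ = ∈-++⁺ʳ (withFirstPart f j n m) (∈-map⁺ (suc m ∷_) rest∈)

    ∈-compositions⁻ : ∀ f j n {rc} → n ≤ f → rc ∈ compositions f j n → IsComposition n rc × All (_≤ t) (drop j rc)
    ∈-compositions⁻ f       j zero    _        (here refl) = ([] , refl) , subst (All (_≤ t)) (sym (List.drop-[] j)) []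
    ∈-compositions⁻ (suc f) j (suc n) (s≤s n≤f) rc∈
      with m , rest , refl , s≤s m≤n , ok , rest∈ ← ∈-withFirstPart⁻ f j n (suc n) rc∈ =
      let (pos , sum≡) , rest≤t = ∈-compositions⁻ f (pred j) (n ∸ m) (ℕ.≤-trans (ℕ.m∸n≤m n m) n≤f) rest∈
      in (s≤s z≤n ∷ pos , cong suc (trans (cong (m +_) sum≡) (ℕ.m+[n∸m]≡n m≤n))) , partAllowed⁻ j (suc m) rest ok rest≤t

    ∈-compositions⁺ : ∀ f j n rc → n ≤ f → IsComposition n rc → All (_≤ t) (drop j rc) → rc ∈ compositions f j n
    ∈-compositions⁺ f       j zero    []           _         _                   _   = here refl
    ∈-compositions⁺ f       j zero    (suc m ∷ rc) _         (_ , ())            _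
    ∈-compositions⁺ f       j n       (zero ∷ rc)  _         (() ∷ _ , _)        _
    ∈-compositions⁺ (suc f) j (suc n) (suc m ∷ rc) (s≤s n≤f) (_ ∷ pos , sum≡) rc≤t =
      let ok , rest≤t = partAllowed⁺ j (suc m) rc rc≤t
          m+sum≡ : m + sum rc ≡ n
          m+sum≡ = ℕ.suc-injective sum≡
          m≤n = subst (m ≤_) m+sum≡ (ℕ.m≤m+n m (sum rc))
          sum≡′ = trans (sym (ℕ.m+n∸m≡n m (sum rc))) (cong (_∸ m) m+sum≡)
      in ∈-withFirstPart⁺ f j n (suc n) m rc (s≤s m≤n) ok
           (∈-compositions⁺ f (pred j) (n ∸ m) rc (ℕ.≤-trans (ℕ.m∸n≤m n m) n≤f) (pos , sum≡′) rest≤t)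

    mutual
      compositions-Unique : ∀ f j n → Unique (compositions f j n)
      compositions-Unique f       j zero    = [] ∷ []
      compositions-Unique zero    j (suc n) = []
      compositions-Unique (suc f) j (suc n) = withFirstPart-Unique f j n (suc n)

      withFirstPart-Unique : ∀ f j n k → Unique (withFirstPart f j n k)
      withFirstPart-Unique f j n zero    = []
      withFirstPart-Unique f j n (suc k) =
        AllPairs-++⁺ (withFirstPart-Unique f j n k) (firstPartExactly-Unique f j n k)
          (All.tabulate λ rc∈ → All.tabulate λ rc′∈ rc≡rc′ →
            let _ , _ , eq , m<k , _ = ∈-withFirstPart⁻ f j n k rc∈
                _ , eq′ , _ = ∈-firstPartExactly⁻ f j n k rc′∈
            in ℕ.<-irrefl (ℕ.suc-injective (List.∷-injectiveˡ (trans (sym eq) (trans rc≡rc′ eq′)))) m<k)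

      firstPartExactly-Unique : ∀ f j n k → Unique (firstPartExactly f j n k)
      firstPartExactly-Unique f j n k with partAllowed j (suc k)
      ... | true  = Unique.map⁺ List.∷-injectiveʳ (compositions-Unique f (pred j) (n ∸ k))
      ... | false = []

  module _ (t : ℕ) where

    Admissible⇒drop-reverse : ∀ s c → Admissible t s c → All (_≤ t) (drop s (reverse c))
    Admissible⇒drop-reverse s []      _ = subst (All (_≤ t)) (sym (List.drop-[] s)) []
    Admissible⇒drop-reverse s (m ∷ c) (short , adm) rewrite List.unfold-reverse m c with length c ℕ.<? s
    ... | yes c<s = subst (All (_≤ t)) (sym (drop-beyond s (reverse c ++ [ m ]) (subst (_≤ s) (sym (length-reverse-∷ʳ c m)) c<s))) []
    ... | no  c≮s rewrite drop-snoc s (reverse c) m (subst (s ≤_) (sym (List.length-reverse c)) (ℕ.≮⇒≥ c≮s)) =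
      All.++⁺ (Admissible⇒drop-reverse s c adm) (m≤t short ∷ [])
      where
        m≤t : m ≤ t ⊎ length c < s → m ≤ t
        m≤t (inj₁ m≤t) = m≤t
        m≤t (inj₂ c<s) = contradiction c<s c≮s

    drop-reverse⇒Admissible : ∀ s c → All (_≤ t) (drop s (reverse c)) → Admissible t s c
    drop-reverse⇒Admissible s []      _ = tt
    drop-reverse⇒Admissible s (m ∷ c) h rewrite List.unfold-reverse m c with length c ℕ.<? s
    ... | yes c<s = inj₂ c<s , drop-reverse⇒Admissible s c
                      (subst (All (_≤ t)) (sym (drop-beyond s (reverse c) (subst (_≤ s) (sym (List.length-reverse c)) (ℕ.<⇒≤ c<s)))) [])
    ... | no  c≮s rewrite drop-snoc s (reverse c) m (subst (s ≤_) (sym (List.length-reverse c)) (ℕ.≮⇒≥ c≮s)) =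
      inj₁ (All.head (All.++⁻ʳ (drop s (reverse c)) h)) , drop-reverse⇒Admissible s c (All.++⁻ˡ (drop s (reverse c)) h)

  -- Correctness of the Boolean definitions

  ⇔ᵇ-sound : ∀ x y → T (x ⇔ᵇ y) → x ≡ y
  ⇔ᵇ-sound true  true  _ = refl
  ⇔ᵇ-sound false false _ = refl

  ⇔ᵇ-refl : ∀ x → T (x ⇔ᵇ x)
  ⇔ᵇ-refl true  = tt
  ⇔ᵇ-refl false = tt

  headIso-sound : ∀ a as b bs → length as ≡ length bs →
    T (headIso a as b bs) → map (comparison a) as ≡ map (comparison b) bs
  headIso-sound a []        b []        _   _ = refl
  headIso-sound a (a′ ∷ as) b (b′ ∷ bs) len h =
    let lt , gt∧rest = Equivalence.to T-∧ h
        gt , rest    = Equivalence.to T-∧ gt∧rest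
    in cong₂ _∷_ (cong₂ _,_ (⇔ᵇ-sound _ _ lt) (⇔ᵇ-sound _ _ gt))
                 (headIso-sound a as b bs (ℕ.suc-injective len) rest)

  headIso-complete : ∀ a as b bs → map (comparison a) as ≡ map (comparison b) bs → T (headIso a as b bs)
  headIso-complete a []        b []        _  = tt
  headIso-complete a (a′ ∷ as) b (b′ ∷ bs) eq with eq₁ , eq₂ ← List.∷-injective eq =
    Equivalence.from T-∧
      ( subst (λ c → T ((a <ᵇ a′) ⇔ᵇ proj₁ c)) eq₁ (⇔ᵇ-refl (a <ᵇ a′))
      , Equivalence.from T-∧ (subst (λ c → T ((a′ <ᵇ a) ⇔ᵇ proj₂ c)) eq₁ (⇔ᵇ-refl (a′ <ᵇ a))
                             , headIso-complete a as b bs eq₂))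

  orderIsoᵇ-sound : ∀ u v → T (orderIsoᵇ u v) → shape u ≡ shape v
  orderIsoᵇ-sound []       []       _ = refl
  orderIsoᵇ-sound (a ∷ as) (b ∷ bs) h =
    let head , rest = Equivalence.to T-∧ h
        tail = orderIsoᵇ-sound as bs rest
    in cong₂ _∷_ (headIso-sound a as b bs (shape-length tail) head) tail

  orderIsoᵇ-complete : ∀ u v → shape u ≡ shape v → T (orderIsoᵇ u v)
  orderIsoᵇ-complete []       []       _ = tt
  orderIsoᵇ-complete (a ∷ as) (b ∷ bs) eq with eq₁ , eq₂ ← List.∷-injective eq =
    Equivalence.from T-∧ (headIso-complete a as b bs eq₁ , orderIsoᵇ-complete as bs eq₂)

  ∈-subseqs⁻ : ∀ k π {u} → u ∈ subseqs k π → u ⊆ π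
  ∈-subseqs⁻ zero    π        (here refl) = minimum π
  ∈-subseqs⁻ (suc k) (a ∷ as) u∈ with ∈-++⁻ (map (a ∷_) (subseqs k as)) u∈
  ... | inj₁ u∈ˡ with u′ , u′∈ , refl ← ∈-map⁻ (a ∷_) u∈ˡ = refl ∷ ∈-subseqs⁻ k as u′∈
  ... | inj₂ u∈ʳ = a ∷ʳ ∈-subseqs⁻ (suc k) as u∈ʳ

  ∈-subseqs⁺ : ∀ {u π} → u ⊆ π → u ∈ subseqs (length u) π
  ∈-subseqs⁺ []                  = here refl
  ∈-subseqs⁺ {[]}    (y ∷ʳ τ)    = here refl
  ∈-subseqs⁺ {x ∷ u} (y ∷ʳ τ)    = ∈-++⁺ʳ (map (y ∷_) (subseqs (length u) _)) (∈-subseqs⁺ τ)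
  ∈-subseqs⁺         (refl ∷ τ)  = ∈-++⁺ˡ (∈-map⁺ (_ ∷_) (∈-subseqs⁺ τ))

  containsᵇ-sound : ∀ π σ → T (containsᵇ π σ) → Contains π σ
  containsᵇ-sound π σ h =
    let u , u∈ , iso = find (any⁻ (λ u → orderIsoᵇ u σ) (subseqs (length σ) π) h)
    in u , ∈-subseqs⁻ (length σ) π u∈ , orderIsoᵇ-sound u σ iso

  containsᵇ-complete : ∀ π σ → Contains π σ → T (containsᵇ π σ)
  containsᵇ-complete π σ (u , τ , eq) = any⁺ (λ u → orderIsoᵇ u σ)
    (lose (subst (λ k → u ∈ subseqs k π) (shape-length eq) (∈-subseqs⁺ τ)) (orderIsoᵇ-complete u σ eq))

  avoidsAllᵇ-sound : ∀ R π → T (avoidsAllᵇ R π) → All (λ σ → ¬ Contains π σ) R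
  avoidsAllᵇ-sound R π h =
    All.map (λ {σ} ¬c c → T-not⁻ _ ¬c (containsᵇ-complete π σ c)) (All.all⁺ _ R h)

  avoidsAllᵇ-complete : ∀ R π → All (λ σ → ¬ Contains π σ) R → T (avoidsAllᵇ R π)
  avoidsAllᵇ-complete R π ¬cs =
    All.all⁻ _ (All.map (λ {σ} ¬c → T-not⁺ _ (¬c ∘ containsᵇ-sound π σ)) ¬cs)

  elemᵇ-sound : ∀ a as → T (elemᵇ a as) → a ∈ as
  elemᵇ-sound a as h = Any.map (ℕ.≡ᵇ⇒≡ a _) (any⁻ _ as h)

  elemᵇ-complete : ∀ a as → a ∈ as → T (elemᵇ a as)
  elemᵇ-complete a as a∈ = any⁺ _ (Any.map (ℕ.≡⇒≡ᵇ a _) a∈)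

  distinctᵇ-sound : ∀ as → T (distinctᵇ as) → Unique as
  distinctᵇ-sound []       _ = []
  distinctᵇ-sound (a ∷ as) h =
    let a∉ , rest = Equivalence.to T-∧ h
    in ¬Any⇒All¬ as (T-not⁻ _ a∉ ∘ elemᵇ-complete a as) ∷ distinctᵇ-sound as rest

  distinctᵇ-complete : ∀ as → Unique as → T (distinctᵇ as)
  distinctᵇ-complete []       _             = tt
  distinctᵇ-complete (a ∷ as) (a≢as ∷ uniq) =
    Equivalence.from T-∧ (T-not⁺ _ (All¬⇒¬Any a≢as ∘ elemᵇ-sound a as) , distinctᵇ-complete as uniq)

  oneTo≡block : ∀ n → oneTo n ≡ block 0 n
  oneTo≡block n = trans (sym (List.map-id (oneTo n))) (shifted-oneTo≡block 0 n)

  ∈-oneTo⁻ : ∀ {n a} → a ∈ oneTo n → 1 ≤ a × a ≤ n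
  ∈-oneTo⁻ {n} a∈ = ∈-block⁻ (subst (_ ∈_) (oneTo≡block n) a∈)

  ∈-oneTo⁺ : ∀ {n a} → 1 ≤ a → a ≤ n → a ∈ oneTo n
  ∈-oneTo⁺ {n} 1≤a a≤n = subst (_ ∈_) (sym (oneTo≡block n)) (∈-block⁺ 0 n 1≤a a≤n)

  isPermᵇ-sound : ∀ n w → T (isPermᵇ n w) → IsPermutation n w
  isPermᵇ-sound n w h =
    let len , rest = Equivalence.to T-∧ h
        uniq , bounds = Equivalence.to T-∧ rest
    in ℕ.≡ᵇ⇒≡ _ _ len , distinctᵇ-sound w uniq ,
       All.map (λ {a} → ∈-oneTo⁻ ∘ elemᵇ-sound a (oneTo n)) (All.all⁺ _ w bounds)

  isPermᵇ-complete : ∀ n w → IsPermutation n w → T (isPermᵇ n w)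
  isPermᵇ-complete n w (len , uniq , bounds) =
    Equivalence.from T-∧ (ℕ.≡⇒≡ᵇ _ _ len , Equivalence.from T-∧ (distinctᵇ-complete w uniq ,
      All.all⁻ _ (All.map (λ {a} (1≤a , a≤n) → elemᵇ-complete a (oneTo n) (∈-oneTo⁺ 1≤a a≤n)) bounds)))

  ∈-words⁺ : ∀ k n w → length w ≡ k → All (_∈ oneTo n) w → w ∈ words k n
  ∈-words⁺ zero    n []      _   _            = here refl
  ∈-words⁺ (suc k) n (a ∷ w) len (a∈ ∷ w∈ₙ) =
    ∈-concatMap⁺ (λ b → map (b ∷_) (words k n)) (Any.map (λ { refl → ∈-map⁺ (a ∷_) (∈-words⁺ k n w (ℕ.suc-injective len) w∈ₙ) }) a∈)

  words-Unique : ∀ k n → Unique (words k n)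
  words-Unique zero    n = [] ∷ []
  words-Unique (suc k) n = Unique.concat⁺
    (All.map⁺ (All.tabulate (λ _ → Unique.map⁺ List.∷-injectiveʳ (words-Unique k n))))
    (AllPairs-map⁺ (AllPairs.map disjoint (Increasing⇒Unique (subst Increasing (sym (oneTo≡block n)) (block-Increasing 0 n)))))
    where
      disjoint : ∀ {a b} → a ≢ b → Disjoint (map (a ∷_) (words k n)) (map (b ∷_) (words k n))
      disjoint a≢b (v∈ , v∈′) with _ , _ , refl ← ∈-map⁻ _ v∈ with _ , _ , eq ← ∈-map⁻ _ v∈′ =
        a≢b (List.∷-injectiveˡ eq)

  module _ (s t : ℕ) where

    R : List (List ℕ)
    R = p132 ∷ p213 ∷ alpha s t ∷ []

    avoiders : ℕ → List (List ℕ)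
    avoiders n = filterᵇ (avoidsAllᵇ R) (perms n)

    -- the reversals of the admissible compositions
    admissibleComps : ℕ → List (List ℕ)
    admissibleComps n = compositions t n s n

    ∈-avoiders⇒layered : ∀ n {π} → π ∈ avoiders n → π ∈ map (layered ∘ reverse) (admissibleComps n)
    ∈-avoiders⇒layered n {π} π∈
      with π∈perms , avoids ← ∈-filter⁻ (T? ∘ avoidsAllᵇ R) {xs = perms n} π∈
      with _ , isPerm ← ∈-filter⁻ (T? ∘ isPermᵇ n) {xs = words n n} π∈perms
      with ¬132 ∷ ¬213 ∷ ¬α ∷ [] ← avoidsAllᵇ-sound R π avoids
      with c , pos , refl , refl ← avoider-layered n π (isPermᵇ-sound n π isPerm) ¬132 ¬213 =
      subst (_∈ map (layered ∘ reverse) (admissibleComps (sum c))) (cong layered (List.reverse-involutive c))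
        (∈-map⁺ (layered ∘ reverse) (∈-compositions⁺ t (sum c) s (sum c) (reverse c) ℕ.≤-refl
          (All-resp-↭ (↭-sym (↭-reverse c)) pos , sum-↭ (↭-reverse c))
          (Admissible⇒drop-reverse t s c
            (avoids-alpha⇒Admissible t s c pos (¬α ∘ subst (Contains (layered c)) (sym (alpha≡ s t)))))))

    layered⇒∈-avoiders : ∀ n {π} → π ∈ map (layered ∘ reverse) (admissibleComps n) → π ∈ avoiders n
    layered⇒∈-avoiders n {π} π∈ with rc , rc∈ , refl ← ∈-map⁻ (layered ∘ reverse) π∈ =
      ∈-filter⁺ (T? ∘ avoidsAllᵇ R)
        (∈-filter⁺ (T? ∘ isPermᵇ n)
          (∈-words⁺ n n (layered c) (proj₁ perm) (All.map (λ (1≤a , a≤n) → ∈-oneTo⁺ 1≤a a≤n) (proj₂ (proj₂ perm))))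
          (isPermᵇ-complete n (layered c) perm))
        (avoidsAllᵇ-complete R (layered c)
          (layered-avoids p132 (λ ()) p132-NoIncreasingTop c ∷
           layered-avoids p213 (λ ()) p213-NoIncreasingTop c ∷
           subst (λ σ → ¬ Contains (layered c) σ) (sym (alpha≡ s t))
             (Admissible⇒avoids-alpha t s c
               (drop-reverse⇒Admissible t s c (subst (All (_≤ t) ∘ drop s) (sym (List.reverse-involutive rc)) rc≤t))) ∷
           []))
      where
        c = reverse rc
        comp = ∈-compositions⁻ t n s n ℕ.≤-refl rc∈
        rc≤t = proj₂ comp
        sum≡ : sum c ≡ n
        sum≡ = trans (sum-↭ (↭-reverse rc)) (proj₂ (proj₁ comp))
        perm : IsPermutation n (layered c)
        perm = trans (length-layered c) sum≡ , layered-Unique c ,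
               All.map (λ { {a} (1≤a , a≤) → 1≤a , subst (a ≤_) sum≡ a≤ }) (layered-bounds c)

    countAvoiders≡ : ∀ n → countAvoiders R n ≡ length (admissibleComps n)
    countAvoiders≡ n = trans
      (Unique-length-≡ avoiders-Unique layeredComps-Unique (∈-avoiders⇒layered n) (layered⇒∈-avoiders n))
      (List.length-map (layered ∘ reverse) (admissibleComps n))
      where
        avoiders-Unique : Unique (avoiders n)
        avoiders-Unique = Unique.filter⁺ (T? ∘ avoidsAllᵇ R) (Unique.filter⁺ (T? ∘ isPermᵇ n) (words-Unique n n))
        layeredComps-Unique : Unique (map (layered ∘ reverse) (admissibleComps n))
        layeredComps-Unique = Unique-map⁺
          (λ posˣ posʸ eq → List.reverse-injective (layered-injective _ _ posˣ posʸ eq))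
          (All.tabulate (λ rc∈ → All-resp-↭ (↭-sym (↭-reverse _)) (proj₁ (proj₁ (∈-compositions⁻ t n s n ℕ.≤-refl rc∈)))))
          (compositions-Unique t n s n)

module CompositionSeries where

  open import Data.Nat using (ℕ; zero; suc; pred; _∸_)
  import Data.Nat.Properties as ℕ
  open import Data.Integer using (ℤ; +_; _+_; _*_)
  import Data.Integer.Properties as ℤ
  open import Data.Bool using (true; false; if_then_else_)
  open import Data.List using (_∷_; length)
  import Data.List.Properties as List
  open import Relation.Binary.PropositionalEquality
  open PowerSeries using (sumBelow-cong)
  open Permutations using (partAllowed; compositions; withFirstPart; firstPartExactly; compositions-fuel)

  module _ (t : ℕ) where

    V : ℕ → FPS
    V j n = + length (compositions t n j n)

    weight : ℕ → ℕ → ℤ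
    weight j i = if partAllowed t j (suc i) then + 1 else + 0

    length-firstPartExactly : ∀ f j n k →
      + length (firstPartExactly t f j n k) ≡ weight j k * + length (compositions t f (pred j) (n ∸ k))
    length-firstPartExactly f j n k with partAllowed t j (suc k)
    ... | true  = trans (cong +_ (List.length-map (suc k ∷_) (compositions t f (pred j) (n ∸ k)))) (sym (ℤ.*-identityˡ _))
    ... | false = sym (ℤ.*-zeroˡ (+ length (compositions t f (pred j) (n ∸ k))))

    length-withFirstPart : ∀ f j n k →
      + length (withFirstPart t f j n k) ≡ sumBelow k (λ i → weight j i * + length (compositions t f (pred j) (n ∸ i)))
    length-withFirstPart f j n zero    = refl
    length-withFirstPart f j n (suc k) = trans (cong +_ (List.length-++ (withFirstPart t f j n k)))
      (cong₂ _+_ (length-withFirstPart f j n k) (length-firstPartExactly f j n k))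

    V-coeff-suc : ∀ j n → V j (suc n) ≡ sumBelow (suc n) (λ i → weight j i * V (pred j) (n ∸ i))
    V-coeff-suc j n = trans (length-withFirstPart n j n (suc n))
      (sumBelow-cong (suc n) (λ i _ → cong (λ cs → weight j i * + length cs)
        (compositions-fuel t n (n ∸ i) (pred j) (n ∸ i) (ℕ.m∸n≤m n i) ℕ.≤-refl)))

open PowerSeries using (⊛-cong; ≈-refl; V⊛denom)
open Permutations using (countAvoiders≡)
open CompositionSeries using (V; V-coeff-suc)
open import Data.Integer using (+_)

mainTheorem3 : (s t : ℕ) → 1 ≤ s → 1 ≤ t →
    (n : ℕ) → (genFun s t ⊛ denom s t) n ≡ numer s t n
mainTheorem3 s t _ _ n = trans
  (⊛-cong (λ k → cong +_ (countAvoiders≡ s t k)) (≈-refl {denom s t}) n)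
  -- weight t 0 and weight t (suc j) reduce to geometricBelow t and geometric
  (V⊛denom t (V t) (λ _ → refl) (V-coeff-suc t 0) (λ j → V-coeff-suc t (suc j)) s n)
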